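{- For every $\mathcal L\in\mathscr L_{29}$ there exists a fractional $\hom(\mathcal M)$-tiling $h$ of $\mathcal L$ with $h_{\min}\geq1/3$ and $w(h)\geq16+\frac13$.
   Context: $\mathcal M$ is the $3$-uniform hypergraph on $\{1,\dots,8\}$ with edges $\{1,2,3\},\{3,4,5\},\{4,5,6\},\{6,7,8\}$. $\mathscr L_{29}$ is the set of $3$-uniform hypergraphs $\mathcal L$ consisting of two vertex-disjoint copies $\mathcal M_1,\mathcal M_2$ of $\mathcal M$ and two additional vertices $u,v$, such that every edge incident to $u$ or $v$ contains precisely one vertex of $V(\mathcal M_1)$ and precisely one vertex of $V(\mathcal M_2)$, and moreover: for all $a\in V(\mathcal M_1)$, $b\in V(\mathcal M_2)$ we have $\{u,a,b\}\in E(\mathcal L)$ iff $\{v,a,b\}\in E(\mathcal L)$; and $\deg(u)=\deg(v)\geq29$. For a $3$-uniform hypergraph $\mathcal L$, a fractional $\hom(\mathcal M)$-tiling is a function $h\colon V(\mathcal L)\times E(\mathcal L)\to[0,1]$ such that (a) $h(v,e)\neq0$ implies $v\in e$; (b) $\sum_{e\in E(\mathcal L)}h(v,e)\leq1$ for every vertex $v$; (c) every edge $e$ admits a labeling $e=xyz$ with $h(x,e)=h(y,e)\geq h(z,e)\geq\frac23h(x,e)$. $h_{\min}$ is the smallest nonzero value of $h$ ($\infty$ if $h\equiv0$), and $w(h)=\sum_{(v,e)\in V(\mathcal L)\times E(\mathcal L)}h(v,e)$. -}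

module Defs where

open import Data.Nat using (ℕ; zero; suc)
open import Data.Bool using (Bool; true; false; if_then_else_)
open import Data.Fin using (Fin; #_; _↑ˡ_; _↑ʳ_)
open import Data.Fin.Properties using (_≟_)
open import Data.List using (List; []; _∷_; _++_; length; lookup; map; foldr; concatMap; allFin)
open import Data.Product using (_×_; _,_; ∃-syntax)
open import Data.Sum using (_⊎_)
open import Data.Integer using (+_)
open import Data.Rational using (ℚ; 0ℚ; 1ℚ; _+_; _*_; _≤_; _/_)
open import Relation.Nullary using (does)
open import Relation.Binary.PropositionalEquality using (_≡_; _≢_)

-- Finite 3-uniform hypergraphs: vertex set Fin n, edge list of triples.
-- An edge (a , b , c) stands for the set {a, b, c}.

Triple : ℕ → Set
Triple n = Fin n × Fin n × Fin n

_∈ₑ_ : ∀ {n} → Fin n → Triple n → Set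
v ∈ₑ (a , b , c) = v ≡ a ⊎ v ≡ b ⊎ v ≡ c

_∈ᵇ_ : ∀ {n} → Fin n → Triple n → Bool
v ∈ᵇ (a , b , c) = if does (v ≟ a) then true else
                   (if does (v ≟ b) then true else does (v ≟ c))

deg : ∀ {n} → List (Triple n) → Fin n → ℕ
deg []       v = 0
deg (e ∷ es) v = if v ∈ᵇ e then suc (deg es v) else deg es v

sumℚ : List ℚ → ℚ
sumℚ = foldr _+_ 0ℚ

module _ {n : ℕ} (E : List (Triple n)) where

  EdgeIx : Set
  EdgeIx = Fin (length E)

  IsLabeling : Triple n → Fin n → Fin n → Fin n → Set
  IsLabeling e@(a , b , c) x y z =
    (x ∈ₑ e × y ∈ₑ e × z ∈ₑ e) ×
    (a ∈ₑ (x , y , z) × b ∈ₑ (x , y , z) × c ∈ₑ (x , y , z))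

  IsFracHomMTiling : (Fin n → EdgeIx → ℚ) → Set
  IsFracHomMTiling h =
    (∀ v e → 0ℚ ≤ h v e × h v e ≤ 1ℚ) ×
    (∀ v e → h v e ≢ 0ℚ → v ∈ₑ lookup E e) ×
    (∀ v → sumℚ (map (h v) (allFin (length E))) ≤ 1ℚ) ×
    (∀ e → ∃[ x ] ∃[ y ] ∃[ z ]
        (IsLabeling (lookup E e) x y z ×
         h x e ≡ h y e × h z e ≤ h x e × ((+ 2 / 3) * h x e) ≤ h z e))

  -- h_min ≥ q  (vacuous when h ≡ 0, as h_min = ∞ then)
  HMinAtLeast : (Fin n → EdgeIx → ℚ) → ℚ → Set
  HMinAtLeast h q = ∀ v e → h v e ≢ 0ℚ → q ≤ h v e

  weight : (Fin n → EdgeIx → ℚ) → ℚ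
  weight h = sumℚ (map (λ v → sumℚ (map (h v) (allFin (length E)))) (allFin n))

-- The hypergraph M on {0,…,7} (paper's {1,…,8} shifted by one).

M-edges : List (Triple 8)
M-edges = (# 0 , # 1 , # 2) ∷ (# 2 , # 3 , # 4) ∷ (# 3 , # 4 , # 5) ∷ (# 5 , # 6 , # 7) ∷ []

-- Members of 𝓛_29, up to isomorphism.  Vertex set Fin 18:
--   0..7  = V(M₁) (vertex i ↦ i),  8..15 = V(M₂) (vertex i ↦ 8+i),
--   16 = u, 17 = v.
-- The link S ⊆ V(M₁) × V(M₂) is common to u and v (the "iff" condition).

inM₁ : Fin 8 → Fin 18
inM₁ i = i ↑ˡ 10

inM₂ : Fin 8 → Fin 18
inM₂ i = 8 ↑ʳ (i ↑ˡ 2)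

uL vL : Fin 18
uL = # 16
vL = # 17

copyEdges : (Fin 8 → Fin 18) → List (Triple 18)
copyEdges f = map (λ { (a , b , c) → (f a , f b , f c) }) M-edges

crossEdges : (Fin 8 → Fin 8 → Bool) → List (Triple 18)
crossEdges S =
  concatMap (λ a → concatMap (λ b →
      if S a b then (uL , inM₁ a , inM₂ b) ∷ (vL , inM₁ a , inM₂ b) ∷ [] else [])
    (allFin 8)) (allFin 8)

L-edges : (Fin 8 → Fin 8 → Bool) → List (Triple 18)
L-edges S = copyEdges inM₁ ++ copyEdges inM₂ ++ crossEdges S

InL29 : (Fin 8 → Fin 8 → Bool) → Set
InL29 S = deg (L-edges S) uL ≡ deg (L-edges S) vL × 29 Data.Nat.≤ deg (L-edges S) uL

module Submission where

-- A member of 𝓛₂₉ is determined by its link S ⊆ V(𝓜₁) × V(𝓜₂): each cell (a,b) ∈ S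
-- contributes the two cross edges uab and vab, and deg(u) = |S| ≥ 29.  The 64 cells are
-- partitioned into 28 classes (ten singletons and eighteen triples), so by pigeonhole some
-- class contains two cells c, d of S.  For each of the 54 pairs {c,d} inside a triple we give
-- an explicit tiling (a "recipe": edges of 𝓛 with values in sixths) that only uses the two
-- copies of 𝓜 and the cross edges of c and d, hence is a tiling of 𝓛 for every S ∋ c, d.

open import Defs
open import Data.Bool as Bool using (Bool; true; false; if_then_else_; _∨_; T)
open import Data.Empty using (⊥-elim)
open import Data.Fin using (Fin; zero; suc; toℕ; #_)
open import Data.Fin.Properties using (_≟_; toℕ≤pred[n]; all?; any?)
open import Data.Integer as ℤ using (+_)
import Data.Integer.Properties as ℤP
import Data.Integer.Tactic.RingSolver as ℤSolver
open import Data.List using (List; []; _∷_; _++_; map; lookup; length; allFin; tabulate;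
  concatMap; filter; cartesianProduct)
import Data.List.Properties as ListP
open import Data.List.Membership.Propositional.Properties using (∈-allFin)
open import Data.List.Relation.Unary.All as All using (All; []; _∷_)
open import Data.Maybe using (Maybe; just; nothing; maybe; is-nothing)
open import Data.Nat as ℕ using (ℕ; zero; suc; z≤n; s≤s)
import Data.Nat.Properties as ℕP
open import Data.Nat.ListAction using (sum)
open import Data.Nat.ListAction.Properties using (sum-++)
import Data.Nat.Tactic.RingSolver as ℕSolver
open import Data.Product using (_×_; _,_; proj₁; proj₂; ∃-syntax)
open import Data.Product.Properties using (≡-dec)
open import Data.Rational as ℚ using (ℚ; 0ℚ; 1ℚ; _≤_; _/_; toℚᵘ)
import Data.Rational.Properties as ℚP
open import Data.Rational.Unnormalised as ℚᵘ using (ℚᵘ; mkℚᵘ; *≡*; *≤*)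
import Data.Rational.Unnormalised.Properties as ℚᵘP
open import Data.Sum using (_⊎_; inj₁; inj₂; [_,_]′)
open import Data.Vec as Vec using (Vec; []; _∷_)
open import Function using (_∘_)
open import Relation.Binary.Definitions using (DecidableEquality)
open import Relation.Binary.PropositionalEquality
open import Relation.Nullary using (Dec; yes; no; does)
open import Relation.Nullary.Decidable using (True; toWitness; _×-dec_; _⊎-dec_; _→-dec_; ¬?; T?)
open import Algebra.Properties.CommutativeSemigroup ℕP.+-commutativeSemigroup using (interchange)

-- Sixths.  All values of our tilings are multiples of 1/6; we compute with numerators in ℕ.

opaque
  sixths : ℕ → ℚ
  sixths n = + n / 6

-- the same number as an unnormalised rational, where sums and products are computed
sixthsᵘ : ℕ → ℚᵘ
sixthsᵘ n = mkℚᵘ (+ n) 5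

opaque
  unfolding sixths

  sixths-0 : sixths 0 ≡ 0ℚ
  sixths-0 = refl

  sixths-2 : sixths 2 ≡ + 1 / 3
  sixths-2 = refl

  sixths-6 : sixths 6 ≡ 1ℚ
  sixths-6 = refl

  sixths-98 : sixths 98 ≡ + 49 / 3
  sixths-98 = refl

  toℚᵘ-sixths : ∀ n → toℚᵘ (sixths n) ℚᵘ.≃ sixthsᵘ n
  toℚᵘ-sixths n = ℚP.toℚᵘ-fromℚᵘ (sixthsᵘ n)

sixths-mono-≤ : ∀ {m n} → m ℕ.≤ n → sixths m ≤ sixths n
sixths-mono-≤ {m} {n} m≤n = ℚP.toℚᵘ-cancel-≤
  (ℚᵘP.≤-respʳ-≃ (ℚᵘP.≃-sym (toℚᵘ-sixths n)) (ℚᵘP.≤-respˡ-≃ (ℚᵘP.≃-sym (toℚᵘ-sixths m))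
    (*≤* (ℤP.*-monoʳ-≤-nonNeg (+ 6) (ℤ.+≤+ m≤n)))))

sixths-+ : ∀ m n → sixths m ℚ.+ sixths n ≡ sixths (m ℕ.+ n)
sixths-+ m n = ℚP.toℚᵘ-injective (ℚᵘP.≃-trans (ℚP.toℚᵘ-homo-+ (sixths m) (sixths n))
  (ℚᵘP.≃-trans (ℚᵘP.+-cong (toℚᵘ-sixths m) (toℚᵘ-sixths n))
  (ℚᵘP.≃-trans sum≃ (ℚᵘP.≃-sym (toℚᵘ-sixths (m ℕ.+ n))))))
  where
  common-denominator : ∀ a b → (a ℤ.* + 6 ℤ.+ b ℤ.* + 6) ℤ.* + 6 ≡ (a ℤ.+ b) ℤ.* + 36
  common-denominator = ℤSolver.solve-∀
  sum≃ : sixthsᵘ m ℚᵘ.+ sixthsᵘ n ℚᵘ.≃ sixthsᵘ (m ℕ.+ n)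
  sum≃ = *≡* (trans (common-denominator (+ m) (+ n)) (cong (ℤ._* + 36) (sym (ℤP.pos-+ m n))))

two-thirds-≤ : ∀ {a b} → 2 ℕ.* a ℕ.≤ 3 ℕ.* b → (+ 2 / 3) ℚ.* sixths a ≤ sixths b
two-thirds-≤ {a} {b} 2a≤3b = ℚP.toℚᵘ-cancel-≤
  (ℚᵘP.≤-respˡ-≃ (ℚᵘP.≃-sym (ℚᵘP.≃-trans (ℚP.toℚᵘ-homo-* (+ 2 / 3) (sixths a))
                                         (ℚᵘP.*-congˡ {mkℚᵘ (+ 2) 2} (toℚᵘ-sixths a))))
  (ℚᵘP.≤-respʳ-≃ (ℚᵘP.≃-sym (toℚᵘ-sixths b))
    (*≤* (subst₂ ℤ._≤_ lhs rhs (ℤ.+≤+ (ℕP.*-monoˡ-≤ 6 2a≤3b))))))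
  where
  lhs : + (2 ℕ.* a ℕ.* 6) ≡ (+ 2 ℤ.* + a) ℤ.* + 6
  lhs = trans (ℤP.pos-* (2 ℕ.* a) 6) (cong (ℤ._* + 6) (ℤP.pos-* 2 a))
  regroup : ∀ c → 3 ℕ.* c ℕ.* 6 ≡ c ℕ.* 18
  regroup = ℕSolver.solve-∀
  rhs : + (3 ℕ.* b ℕ.* 6) ≡ + b ℤ.* + 18
  rhs = trans (cong +_ (regroup b)) (ℤP.pos-* b 18)

map-lookup-allFin : ∀ {A B : Set} (f : A → B) (xs : List A) →
  map (f ∘ lookup xs) (allFin (length xs)) ≡ map f xs
map-lookup-allFin f xs = begin
  map (f ∘ lookup xs) (tabulate (λ i → i))  ≡⟨ ListP.map-tabulate (λ i → i) (f ∘ lookup xs) ⟩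
  tabulate (f ∘ lookup xs)                  ≡⟨ ListP.map-tabulate (lookup xs) f ⟨
  map f (tabulate (lookup xs))              ≡⟨ cong (map f) (ListP.tabulate-lookup xs) ⟩
  map f xs                                  ∎
  where open ≡-Reasoning

sumℚ-sixths : ∀ {A : Set} (g : A → ℕ) xs → sumℚ (map (sixths ∘ g) xs) ≡ sixths (sum (map g xs))
sumℚ-sixths g [] = sym sixths-0
sumℚ-sixths g (x ∷ xs) = trans (cong (sixths (g x) ℚ.+_) (sumℚ-sixths g xs)) (sixths-+ (g x) _)

sum-map-++ : ∀ {A : Set} (f : A → ℕ) xs ys → sum (map f (xs ++ ys)) ≡ sum (map f xs) ℕ.+ sum (map f ys)
sum-map-++ f xs ys = trans (cong sum (ListP.map-++ f xs ys)) (sum-++ (map f xs) (map f ys))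

sum-concatMap : ∀ {A B : Set} (f : B → ℕ) (g : A → List B) xs →
  sum (map f (concatMap g xs)) ≡ sum (map (λ x → sum (map f (g x))) xs)
sum-concatMap f g [] = refl
sum-concatMap f g (x ∷ xs) =
  trans (sum-map-++ f (g x) (concatMap g xs)) (cong (sum (map f (g x)) ℕ.+_) (sum-concatMap f g xs))

sum-cartesianProduct : ∀ {A B : Set} (f : A × B → ℕ) xs ys →
  sum (map f (cartesianProduct xs ys)) ≡ sum (map (λ a → sum (map (λ b → f (a , b)) ys)) xs)
sum-cartesianProduct f [] ys = refl
sum-cartesianProduct f (x ∷ xs) ys =
  trans (sum-map-++ f (map (x ,_) ys) (cartesianProduct xs ys))
        (cong₂ ℕ._+_ (cong sum (sym (ListP.map-∘ ys))) (sum-cartesianProduct f xs ys))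

sum-tabulate-+ : ∀ {m} (f g : Fin m → ℕ) →
  sum (tabulate (λ k → f k ℕ.+ g k)) ≡ sum (tabulate f) ℕ.+ sum (tabulate g)
sum-tabulate-+ {zero} f g = refl
sum-tabulate-+ {suc m} f g = trans
  (cong (f zero ℕ.+ g zero ℕ.+_) (sum-tabulate-+ (f ∘ suc) (g ∘ suc)))
  (interchange (f zero) (g zero) (sum (tabulate (f ∘ suc))) (sum (tabulate (g ∘ suc))))

sum-tabulate-0 : ∀ m → sum (tabulate {n = m} (λ _ → 0)) ≡ 0
sum-tabulate-0 zero = refl
sum-tabulate-0 (suc m) = sum-tabulate-0 m

sum-tabulate-point : ∀ {m} (j : Fin m) y → sum (tabulate (λ k → if does (j ≟ k) then y else 0)) ≡ y
sum-tabulate-point {suc m} zero y = trans (cong (y ℕ.+_) (sum-tabulate-0 m)) (ℕP.+-identityʳ y)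
sum-tabulate-point {suc m} (suc j) y = sum-tabulate-point j y

sum-tabulate-≤1 : ∀ {m} (f : Fin m → ℕ) → (∀ k → f k ℕ.≤ 1) → sum (tabulate f) ℕ.≤ m
sum-tabulate-≤1 {zero} f f≤1 = z≤n
sum-tabulate-≤1 {suc m} f f≤1 = ℕP.+-mono-≤ (f≤1 zero) (sum-tabulate-≤1 (f ∘ suc) (f≤1 ∘ suc))

module Pigeonhole {A : Set} {m : ℕ} (cls : A → Fin m) (w : A → ℕ) where

  classWeight : List A → Fin m → ℕ
  classWeight xs k = sum (map w (filter (λ a → cls a ≟ k) xs))

  classWeight-∷ : ∀ x xs k →
    classWeight (x ∷ xs) k ≡ (if does (cls x ≟ k) then w x else 0) ℕ.+ classWeight xs k
  classWeight-∷ x xs k with does (cls x ≟ k)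
  ... | true = refl
  ... | false = refl

  sum-classes : ∀ xs → sum (map w xs) ≡ sum (tabulate (classWeight xs))
  sum-classes [] = sym (sum-tabulate-0 m)
  sum-classes (x ∷ xs) = begin
    w x ℕ.+ sum (map w xs)
      ≡⟨ cong₂ ℕ._+_ (sym (sum-tabulate-point (cls x) (w x))) (sum-classes xs) ⟩
    sum (tabulate (λ k → if does (cls x ≟ k) then w x else 0)) ℕ.+ sum (tabulate (classWeight xs))
      ≡⟨ sum-tabulate-+ (λ k → if does (cls x ≟ k) then w x else 0) (classWeight xs) ⟨
    sum (tabulate (λ k → (if does (cls x ≟ k) then w x else 0) ℕ.+ classWeight xs k))
      ≡⟨ cong sum (ListP.tabulate-cong (λ k → sym (classWeight-∷ x xs k))) ⟩
    sum (tabulate (classWeight (x ∷ xs))) ∎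
    where open ≡-Reasoning

  pigeonhole : ∀ xs → m ℕ.< sum (map w xs) → ∃[ k ] 2 ℕ.≤ classWeight xs k
  pigeonhole xs m<total with any? (λ k → 2 ℕ.≤? classWeight xs k)
  ... | yes heavy = heavy
  ... | no ¬heavy = ⊥-elim (ℕP.<⇒≱ m<total (subst (ℕ._≤ m) (sym (sum-classes xs))
          (sum-tabulate-≤1 (classWeight xs) (λ k → ℕP.≤-pred (ℕP.≰⇒> (λ 2≤ → ¬heavy (k , 2≤)))))))

open Pigeonhole using (pigeonhole)

module _ {n : ℕ} where

  _≟ₜ_ : DecidableEquality (Triple n)
  _≟ₜ_ = ≡-dec _≟_ (≡-dec _≟_ _≟_)

  _∈ₑ?_ : ∀ v (t : Triple n) → Dec (v ∈ₑ t)
  v ∈ₑ? (a , b , c) = (v ≟ a) ⊎-dec ((v ≟ b) ⊎-dec (v ≟ c))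

  -- An entry puts `top` sixths on the vertices x, y of its edge and `low` sixths on z,
  -- realising condition (c) with the labelling e = xyz.
  record Entry : Set where
    constructor entry
    field
      edge     : Triple n
      x y z    : Fin n
      top low  : Fin 7
  open Entry

  -- the value pairs allowed by (c) together with h_min ≥ 1/3, in sixths
  Admissible : ℕ → ℕ → Set
  Admissible t l = 2 ℕ.≤ l × l ℕ.≤ t × 2 ℕ.* t ℕ.≤ 3 ℕ.* l

  -- (IsLabeling does not depend on its edge-list argument, for which we pass [].)
  Valid : Entry → Set
  Valid r = IsLabeling [] (edge r) (x r) (y r) (z r) ×
            x r ≢ y r × x r ≢ z r × y r ≢ z r × Admissible (toℕ (top r)) (toℕ (low r))

  -- validity of an entry is decidable, so recipes can be checked by evaluation
  valid? : ∀ r → Dec (Valid r)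
  valid? r = labelling? ×-dec ¬? (x r ≟ y r) ×-dec ¬? (x r ≟ z r) ×-dec ¬? (y r ≟ z r) ×-dec admissible?
    where
    labelling? : Dec (IsLabeling [] (edge r) (x r) (y r) (z r))
    labelling? with edge r
    ... | (a , b , c) = (x r ∈ₑ? (a , b , c) ×-dec y r ∈ₑ? (a , b , c) ×-dec z r ∈ₑ? (a , b , c)) ×-dec
                        (a ∈ₑ? (x r , y r , z r) ×-dec b ∈ₑ? (x r , y r , z r) ×-dec c ∈ₑ? (x r , y r , z r))
    admissible? : Dec (Admissible (toℕ (top r)) (toℕ (low r)))
    admissible? = 2 ℕ.≤? toℕ (low r) ×-dec toℕ (low r) ℕ.≤? toℕ (top r) ×-dec
                  2 ℕ.* toℕ (top r) ℕ.≤? 3 ℕ.* toℕ (low r)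

  -- A recipe describes a tiling by its entries; edges without an entry get 0.
  Recipe : Set
  Recipe = List Entry

  entryAt : Recipe → Triple n → Maybe Entry
  entryAt [] t = nothing
  entryAt (r ∷ R) t with t ≟ₜ edge r
  ... | yes _ = just r
  ... | no  _ = entryAt R t

  valueAt : Entry → Fin n → ℕ
  valueAt r v = if does (v ≟ x r) then toℕ (top r) else
                if does (v ≟ y r) then toℕ (top r) else
                if does (v ≟ z r) then toℕ (low r) else 0

  assign : Recipe → Fin n → Triple n → ℕ
  assign R v t = maybe (λ r → valueAt r v) 0 (entryAt R t)

  Unassigned : Recipe → Triple n → Set
  Unassigned R t = T (is-nothing (entryAt R t))

  unassigned-0 : ∀ R t → Unassigned R t → ∀ v → assign R v t ≡ 0
  unassigned-0 R t _ v with entryAt R t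
  ... | nothing = refl

  load : List (Triple n) → Recipe → Fin n → ℕ
  load E R v = sum (map (assign R v) E)

  totalLoad : List (Triple n) → Recipe → ℕ
  totalLoad E R = sum (map (load E R) (allFin n))

  entryAt-sound : ∀ R t {r} → All Valid R → entryAt R t ≡ just r → t ≡ edge r × Valid r
  entryAt-sound (r ∷ R) t (vr ∷ vR) eq with t ≟ₜ edge r
  entryAt-sound (r ∷ R) t (vr ∷ vR) refl | yes t≡ = t≡ , vr
  ... | no _ = entryAt-sound R t vR eq

  valueAt-x : ∀ r → valueAt r (x r) ≡ toℕ (top r)
  valueAt-x r with x r ≟ x r
  ... | yes _ = refl
  ... | no x≢x = ⊥-elim (x≢x refl)

  valueAt-y : ∀ r → x r ≢ y r → valueAt r (y r) ≡ toℕ (top r)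
  valueAt-y r x≢y with y r ≟ x r | y r ≟ y r
  ... | yes y≡x | _ = ⊥-elim (x≢y (sym y≡x))
  ... | no _ | yes _ = refl
  ... | no _ | no y≢y = ⊥-elim (y≢y refl)

  valueAt-z : ∀ r → x r ≢ z r → y r ≢ z r → valueAt r (z r) ≡ toℕ (low r)
  valueAt-z r x≢z y≢z with z r ≟ x r | z r ≟ y r | z r ≟ z r
  ... | yes z≡x | _ | _ = ⊥-elim (x≢z (sym z≡x))
  ... | no _ | yes z≡y | _ = ⊥-elim (y≢z (sym z≡y))
  ... | no _ | no _ | yes _ = refl
  ... | no _ | no _ | no z≢z = ⊥-elim (z≢z refl)

  valueAt-support : ∀ r v → valueAt r v ≢ 0 → v ∈ₑ (x r , y r , z r)
  valueAt-support r v ≢0 with v ≟ x r | v ≟ y r | v ≟ z r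
  ... | yes v≡x | _ | _ = inj₁ v≡x
  ... | no _ | yes v≡y | _ = inj₂ (inj₁ v≡y)
  ... | no _ | no _ | yes v≡z = inj₂ (inj₂ v≡z)
  ... | no _ | no _ | no _ = ⊥-elim (≢0 refl)

  valueAt-cases : ∀ r v → valueAt r v ≡ 0 ⊎ valueAt r v ≡ toℕ (top r) ⊎ valueAt r v ≡ toℕ (low r)
  valueAt-cases r v with v ≟ x r | v ≟ y r | v ≟ z r
  ... | yes _ | _ | _ = inj₂ (inj₁ refl)
  ... | no _ | yes _ | _ = inj₂ (inj₁ refl)
  ... | no _ | no _ | yes _ = inj₂ (inj₂ refl)
  ... | no _ | no _ | no _ = inj₁ refl

  valueAt-≤6 : ∀ r v → valueAt r v ℕ.≤ 6
  valueAt-≤6 r v with valueAt-cases r v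
  ... | inj₁ eq = subst (ℕ._≤ 6) (sym eq) z≤n
  ... | inj₂ (inj₁ eq) = subst (ℕ._≤ 6) (sym eq) (toℕ≤pred[n] (top r))
  ... | inj₂ (inj₂ eq) = subst (ℕ._≤ 6) (sym eq) (toℕ≤pred[n] (low r))

  module _ (R : Recipe) (valid : All Valid R) where

    assign-≤6 : ∀ v t → assign R v t ℕ.≤ 6
    assign-≤6 v t with entryAt R t
    ... | nothing = z≤n
    ... | just r = valueAt-≤6 r v

    assign-support : ∀ v t → assign R v t ≢ 0 → v ∈ₑ t
    assign-support v t ≢0 with entryAt R t in eq
    ... | nothing = ⊥-elim (≢0 refl)
    ... | just r with entryAt-sound R t valid eq
    ...   | refl , ((x∈ , y∈ , z∈) , _) , _ with valueAt-support r v ≢0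
    ...     | inj₁ refl = x∈
    ...     | inj₂ (inj₁ refl) = y∈
    ...     | inj₂ (inj₂ refl) = z∈

    assign-min : ∀ v t → assign R v t ≡ 0 ⊎ 2 ℕ.≤ assign R v t
    assign-min v t with entryAt R t in eq
    ... | nothing = inj₁ refl
    ... | just r with entryAt-sound R t valid eq
    ...   | _ , _ , _ , _ , _ , (2≤low , low≤top , _) with valueAt-cases r v
    ...     | inj₁ eq₀ = inj₁ eq₀
    ...     | inj₂ (inj₁ eqₜ) = inj₂ (subst (2 ℕ.≤_) (sym eqₜ) (ℕP.≤-trans 2≤low low≤top))
    ...     | inj₂ (inj₂ eqₗ) = inj₂ (subst (2 ℕ.≤_) (sym eqₗ) 2≤low)

    assign-labelling : ∀ t → ∃[ x ] ∃[ y ] ∃[ z ] (IsLabeling [] t x y z ×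
      assign R x t ≡ assign R y t × assign R z t ℕ.≤ assign R x t × 2 ℕ.* assign R x t ℕ.≤ 3 ℕ.* assign R z t)
    assign-labelling t@(a , b , c) with entryAt R t in eq
    ... | nothing = a , b , c , in-order , refl , z≤n , z≤n
      where
      in-order : IsLabeling [] t a b c
      in-order = (inj₁ refl , inj₂ (inj₁ refl) , inj₂ (inj₂ refl)) ,
                 (inj₁ refl , inj₂ (inj₁ refl) , inj₂ (inj₂ refl))
    ... | just r with entryAt-sound R t valid eq
    ...   | refl , lab , x≢y , x≢z , y≢z , (_ , low≤top , ratio) =
      x r , y r , z r , lab , trans hx (sym hy) ,
      subst₂ ℕ._≤_ (sym hz) (sym hx) low≤top ,
      subst₂ (λ p q → 2 ℕ.* p ℕ.≤ 3 ℕ.* q) (sym hx) (sym hz) ratio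
      where
      hx : valueAt r (x r) ≡ toℕ (top r)
      hx = valueAt-x r
      hy : valueAt r (y r) ≡ toℕ (top r)
      hy = valueAt-y r x≢y
      hz : valueAt r (z r) ≡ toℕ (low r)
      hz = valueAt-z r x≢z y≢z

    recipe-tiling : (E : List (Triple n)) → (∀ v → load E R v ℕ.≤ 6) → ∀ {k} → k ℕ.≤ totalLoad E R →
      ∃[ h ] (IsFracHomMTiling E h × HMinAtLeast E h (+ 1 / 3) × sixths k ≤ weight E h)
    recipe-tiling E packed {k} k≤total =
      h , (range , support , packing , labelling) , h-min , heavy
      where
      h : Fin n → EdgeIx E → ℚ
      h v e = sixths (assign R v (lookup E e))

      row : ∀ v → sumℚ (map (h v) (allFin (length E))) ≡ sixths (load E R v)
      row v = trans (cong sumℚ (map-lookup-allFin (sixths ∘ assign R v) E)) (sumℚ-sixths (assign R v) E)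

      nonzero : ∀ v e → h v e ≢ 0ℚ → assign R v (lookup E e) ≢ 0
      nonzero v e h≢0 a≡0 = h≢0 (trans (cong sixths a≡0) sixths-0)

      range : ∀ v e → 0ℚ ≤ h v e × h v e ≤ 1ℚ
      range v e = subst (_≤ h v e) sixths-0 (sixths-mono-≤ z≤n) ,
                  subst (h v e ≤_) sixths-6 (sixths-mono-≤ (assign-≤6 v (lookup E e)))

      support : ∀ v e → h v e ≢ 0ℚ → v ∈ₑ lookup E e
      support v e h≢0 = assign-support v (lookup E e) (nonzero v e h≢0)

      packing : ∀ v → sumℚ (map (h v) (allFin (length E))) ≤ 1ℚ
      packing v = subst₂ _≤_ (sym (row v)) sixths-6 (sixths-mono-≤ (packed v))

      labelling : ∀ e → ∃[ x ] ∃[ y ] ∃[ z ] (IsLabeling E (lookup E e) x y z ×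
        h x e ≡ h y e × h z e ≤ h x e × ((+ 2 / 3) ℚ.* h x e) ≤ h z e)
      labelling e with assign-labelling (lookup E e)
      ... | x , y , z , lab , x≡y , z≤x , ratio =
        x , y , z , lab , cong sixths x≡y , sixths-mono-≤ z≤x , two-thirds-≤ ratio

      h-min : HMinAtLeast E h (+ 1 / 3)
      h-min v e h≢0 with assign-min v (lookup E e)
      ... | inj₁ a≡0 = ⊥-elim (nonzero v e h≢0 a≡0)
      ... | inj₂ 2≤a = subst (_≤ h v e) sixths-2 (sixths-mono-≤ 2≤a)

      heavy : sixths k ≤ weight E h
      heavy = subst (sixths k ≤_) (sym total) (sixths-mono-≤ k≤total)
        where
        total : weight E h ≡ sixths (totalLoad E R)
        total = trans (cong sumℚ (ListP.map-cong row (allFin n))) (sumℚ-sixths (load E R) (allFin n))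

incidence : ∀ {n} → Fin n → Triple n → ℕ
incidence v e = if v ∈ᵇ e then 1 else 0

deg-sum : ∀ {n} (E : List (Triple n)) v → deg E v ≡ sum (map (incidence v) E)
deg-sum [] v = refl
deg-sum (e ∷ E) v with v ∈ᵇ e
... | true = cong suc (deg-sum E v)
... | false = deg-sum E v

Link : Set
Link = Fin 8 → Fin 8 → Bool

Cell : Set
Cell = Fin 8 × Fin 8

cells : List Cell
cells = cartesianProduct (allFin 8) (allFin 8)

Present : Link → Cell → Set
Present S (a , b) = S a b ≡ true

presence : Link → Cell → ℕ
presence S (a , b) = if S a b then 1 else 0

presence-≤1 : ∀ S c → presence S c ℕ.≤ 1
presence-≤1 S (a , b) with S a b
... | true = s≤s z≤n
... | false = z≤n

cellEdges : Link → Fin 8 → Fin 8 → List (Triple 18)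
cellEdges S a b = if S a b then (uL , inM₁ a , inM₂ b) ∷ (vL , inM₁ a , inM₂ b) ∷ [] else []

cellSum : (Triple 18 → ℕ) → Link → Cell → ℕ
cellSum f S (a , b) = sum (map f (cellEdges S a b))

sum-crossEdges : ∀ (f : Triple 18 → ℕ) S → sum (map f (crossEdges S)) ≡ sum (map (cellSum f S) cells)
sum-crossEdges f S = begin
  sum (map f (crossEdges S))
    ≡⟨ sum-concatMap f (λ a → concatMap (cellEdges S a) (allFin 8)) (allFin 8) ⟩
  sum (map (λ a → sum (map f (concatMap (cellEdges S a) (allFin 8)))) (allFin 8))
    ≡⟨ cong sum (ListP.map-cong (λ a → sum-concatMap f (cellEdges S a) (allFin 8)) (allFin 8)) ⟩
  sum (map (λ a → sum (map (λ b → cellSum f S (a , b)) (allFin 8))) (allFin 8))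
    ≡⟨ sum-cartesianProduct (cellSum f S) (allFin 8) (allFin 8) ⟨
  sum (map (cellSum f S) cells) ∎
  where open ≡-Reasoning

sum-L-edges : ∀ (f : Triple 18 → ℕ) S → sum (map f (L-edges S)) ≡
  sum (map f (copyEdges inM₁)) ℕ.+ (sum (map f (copyEdges inM₂)) ℕ.+ sum (map (cellSum f S) cells))
sum-L-edges f S = begin
  sum (map f (copyEdges inM₁ ++ copyEdges inM₂ ++ crossEdges S))
    ≡⟨ sum-map-++ f (copyEdges inM₁) (copyEdges inM₂ ++ crossEdges S) ⟩
  sum (map f (copyEdges inM₁)) ℕ.+ sum (map f (copyEdges inM₂ ++ crossEdges S))
    ≡⟨ cong (sum (map f (copyEdges inM₁)) ℕ.+_) (sum-map-++ f (copyEdges inM₂) (crossEdges S)) ⟩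
  sum (map f (copyEdges inM₁)) ℕ.+ (sum (map f (copyEdges inM₂)) ℕ.+ sum (map f (crossEdges S)))
    ≡⟨ cong (λ s → sum (map f (copyEdges inM₁)) ℕ.+ (sum (map f (copyEdges inM₂)) ℕ.+ s)) (sum-crossEdges f S) ⟩
  sum (map f (copyEdges inM₁)) ℕ.+ (sum (map f (copyEdges inM₂)) ℕ.+ sum (map (cellSum f S) cells)) ∎
  where open ≡-Reasoning

u∉vab : ∀ a b → incidence uL (vL , inM₁ a , inM₂ b) ≡ 0
u∉vab = toWitness {a? = all? λ a → all? λ b → incidence uL (vL , inM₁ a , inM₂ b) ℕ.≟ 0} _

deg-u : ∀ S → deg (L-edges S) uL ≡ sum (map (presence S) cells)
deg-u S = trans (deg-sum (L-edges S) uL)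
  (trans (sum-L-edges (incidence uL) S) (cong sum (ListP.map-cong cell cells)))
  where
  cell : ∀ c → cellSum (incidence uL) S c ≡ presence S c
  cell (a , b) with S a b
  ... | true = cong suc (trans (ℕP.+-identityʳ _) (u∉vab a b))
  ... | false = refl

sum-restrict : ∀ (f : Triple 18 → ℕ) (S S' : Link) →
  (∀ a b → S' a b ≡ true → S a b ≡ true) →
  (∀ a b → S' a b ≡ false → f (uL , inM₁ a , inM₂ b) ≡ 0 × f (vL , inM₁ a , inM₂ b) ≡ 0) →
  sum (map f (L-edges S)) ≡ sum (map f (L-edges S'))
sum-restrict f S S' S'⊆S vanish = begin
  sum (map f (L-edges S))
    ≡⟨ sum-L-edges f S ⟩
  sum (map f (copyEdges inM₁)) ℕ.+ (sum (map f (copyEdges inM₂)) ℕ.+ sum (map (cellSum f S) cells))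
    ≡⟨ cong (λ s → sum (map f (copyEdges inM₁)) ℕ.+ (sum (map f (copyEdges inM₂)) ℕ.+ s))
            (cong sum (ListP.map-cong cell cells)) ⟩
  sum (map f (copyEdges inM₁)) ℕ.+ (sum (map f (copyEdges inM₂)) ℕ.+ sum (map (cellSum f S') cells))
    ≡⟨ sum-L-edges f S' ⟨
  sum (map f (L-edges S')) ∎
  where
  open ≡-Reasoning
  cell : ∀ c → cellSum f S c ≡ cellSum f S' c
  cell (a , b) with S' a b in eq′
  ... | true rewrite S'⊆S a b eq′ = refl
  ... | false with S a b | vanish a b eq′
  ...   | false | _ = refl
  ...   | true | fu≡0 , fv≡0 rewrite fu≡0 | fv≡0 = refl

GoodTiling : ∀ {n} → List (Triple n) → Set
GoodTiling E = ∃[ h ] (IsFracHomMTiling E h × HMinAtLeast E h (+ 1 / 3) × (+ 49 / 3) ≤ weight E h)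

_≟ᶜ_ : DecidableEquality Cell
_≟ᶜ_ = ≡-dec _≟_ _≟_

pairLink : Cell → Cell → Link
pairLink c d a b = does ((a , b) ≟ᶜ c) ∨ does ((a , b) ≟ᶜ d)

pairLink-⊆ : ∀ S c d → Present S c → Present S d → ∀ a b → pairLink c d a b ≡ true → S a b ≡ true
pairLink-⊆ S c d Sc Sd a b with (a , b) ≟ᶜ c | (a , b) ≟ᶜ d
... | yes refl | _ = λ _ → Sc
... | no _ | yes refl = λ _ → Sd
... | no _ | no _ = λ ()

Certificate : Recipe {18} → Cell → Cell → Set
Certificate R c d =
  All Valid R ×
  (∀ a b → pairLink c d a b ≡ false →
     Unassigned R (uL , inM₁ a , inM₂ b) × Unassigned R (vL , inM₁ a , inM₂ b)) ×
  (∀ v → load (L-edges (pairLink c d)) R v ℕ.≤ 6) ×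
  98 ℕ.≤ totalLoad (L-edges (pairLink c d)) R

certificate? : ∀ R c d → Dec (Certificate R c d)
certificate? R c d =
  All.all? valid? R ×-dec
  all? (λ a → all? λ b → (pairLink c d a b Bool.≟ false) →-dec
    (T? (is-nothing (entryAt R (uL , inM₁ a , inM₂ b))) ×-dec T? (is-nothing (entryAt R (vL , inM₁ a , inM₂ b))))) ×-dec
  all? (λ v → load (L-edges (pairLink c d)) R v ℕ.≤? 6) ×-dec
  98 ℕ.≤? totalLoad (L-edges (pairLink c d)) R

superlink-tiling : ∀ R (S S' : Link) → All Valid R →
  (∀ a b → S' a b ≡ true → S a b ≡ true) →
  (∀ a b → S' a b ≡ false → Unassigned R (uL , inM₁ a , inM₂ b) × Unassigned R (vL , inM₁ a , inM₂ b)) →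
  (∀ v → load (L-edges S') R v ℕ.≤ 6) → 98 ℕ.≤ totalLoad (L-edges S') R →
  GoodTiling (L-edges S)
superlink-tiling R S S' valid S'⊆S outside packed heavy =
  let h , tiling , h-min , bound = recipe-tiling R valid (L-edges S) packed′ heavy′
  in h , tiling , h-min , subst (_≤ weight (L-edges S) h) sixths-98 bound
  where
  same-load : ∀ v → load (L-edges S) R v ≡ load (L-edges S') R v
  same-load v = sum-restrict (assign R v) S S' S'⊆S
    (λ a b out → unassigned-0 R _ (proj₁ (outside a b out)) v , unassigned-0 R _ (proj₂ (outside a b out)) v)
  packed′ : ∀ v → load (L-edges S) R v ℕ.≤ 6
  packed′ v = subst (ℕ._≤ 6) (sym (same-load v)) (packed v)
  heavy′ : 98 ℕ.≤ totalLoad (L-edges S) R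
  heavy′ = subst (98 ℕ.≤_) (sym (cong sum (ListP.map-cong same-load (allFin 18)))) heavy

PairCertified : Cell → Cell → Set
PairCertified c d = ∀ S → Present S c → Present S d → GoodTiling (L-edges S)

certificate-sound : ∀ R c d → Certificate R c d → PairCertified c d
certificate-sound R c d (valid , outside , packed , heavy) S Sc Sd =
  superlink-tiling R S (pairLink c d) valid (pairLink-⊆ S c d Sc Sd) outside packed heavy

record PairRecipe : Set where
  constructor pairRecipe
  field
    cell₁ cell₂ : Cell
    recipe      : Recipe {18}
open PairRecipe

by-recipe : (P : PairRecipe) → {True (certificate? (recipe P) (cell₁ P) (cell₂ P))} →
  PairCertified (cell₁ P) (cell₂ P)
by-recipe P {ok} = certificate-sound (recipe P) (cell₁ P) (cell₂ P) (toWitness ok)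

Certified : List Cell → Set
Certified cs = ∀ S → 2 ℕ.≤ sum (map (presence S) cs) → GoodTiling (L-edges S)

singleton : ∀ c → Certified (c ∷ [])
singleton c S 2≤ = ⊥-elim (ℕP.<⇒≱ 2≤ (ℕP.+-monoˡ-≤ 0 (presence-≤1 S c)))

two-of-three : ∀ p q r → 2 ℕ.≤ (if p then 1 else 0) ℕ.+ ((if q then 1 else 0) ℕ.+ ((if r then 1 else 0) ℕ.+ 0)) →
  (p ≡ true × q ≡ true) ⊎ (p ≡ true × r ≡ true) ⊎ (q ≡ true × r ≡ true)
two-of-three true  true  _     _ = inj₁ (refl , refl)
two-of-three true  false true  _ = inj₂ (inj₁ (refl , refl))
two-of-three false true  true  _ = inj₂ (inj₂ (refl , refl))
two-of-three true  false false (s≤s ())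
two-of-three false true  false (s≤s ())
two-of-three false false true  (s≤s ())
two-of-three false false false ()

triple : ∀ {c d e} → PairCertified c d → PairCertified c e → PairCertified d e → Certified (c ∷ d ∷ e ∷ [])
triple {c} {d} {e} cd ce de S 2≤ =
  [ (λ (Sc , Sd) → cd S Sc Sd) , [ (λ (Sc , Se) → ce S Sc Se) , (λ (Sd , Se) → de S Sd Se) ]′ ]′
  (two-of-three (S (proj₁ c) (proj₂ c)) (S (proj₁ d) (proj₂ d)) (S (proj₁ e) (proj₂ e)) 2≤)

-- The partition of the 64 cells into 28 classes: cell (a, b) lies in class classTable[a][b].
-- Classes 0–9 are singletons; classes 10–27 are triples.

classTable : Vec (Vec (Fin 28) 8) 8
classTable =
  (# 11 ∷ # 10 ∷ # 12 ∷ # 13 ∷ # 13 ∷ # 14 ∷ # 15 ∷ # 15 ∷ []) ∷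
  (# 11 ∷ # 10 ∷ # 13 ∷ # 12 ∷ # 12 ∷ # 15 ∷ # 14 ∷ # 14 ∷ []) ∷
  (# 10 ∷ # 11 ∷ # 0 ∷ # 16 ∷ # 17 ∷ # 1 ∷ # 22 ∷ # 23 ∷ []) ∷
  (# 19 ∷ # 19 ∷ # 18 ∷ # 17 ∷ # 16 ∷ # 20 ∷ # 21 ∷ # 21 ∷ []) ∷
  (# 18 ∷ # 18 ∷ # 19 ∷ # 17 ∷ # 16 ∷ # 21 ∷ # 20 ∷ # 20 ∷ []) ∷
  (# 4 ∷ # 5 ∷ # 2 ∷ # 6 ∷ # 7 ∷ # 3 ∷ # 8 ∷ # 9 ∷ []) ∷
  (# 25 ∷ # 25 ∷ # 24 ∷ # 27 ∷ # 27 ∷ # 26 ∷ # 23 ∷ # 22 ∷ []) ∷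
  (# 24 ∷ # 24 ∷ # 25 ∷ # 26 ∷ # 26 ∷ # 27 ∷ # 23 ∷ # 22 ∷ []) ∷
  []

cellClass : Cell → Fin 28
cellClass (a , b) = Vec.lookup (Vec.lookup classTable a) b

members : Fin 28 → List Cell
members k = filter (λ c → cellClass c ≟ k) cells

-- An entry
-- 'entry e x y z t l' puts t/6 on x and y and l/6 on z in the edge e; vertices are
-- numbered as in Defs (0–7 for 𝓜₁, 8–15 for 𝓜₂, 16 = u, 17 = v).  The recipe p-ab-cd is
-- for the pair of cells (a, b), (c, d).

p-01-11 : PairRecipe
p-01-11 = pairRecipe (# 0 , # 1) (# 1 , # 1)
  ( entry (# 0 , # 1 , # 2) (# 0) (# 1) (# 2) (# 3) (# 2)
  ∷ entry (# 2 , # 3 , # 4) (# 2) (# 3) (# 4) (# 4) (# 4)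
  ∷ entry (# 3 , # 4 , # 5) (# 3) (# 4) (# 5) (# 2) (# 2)
  ∷ entry (# 5 , # 6 , # 7) (# 6) (# 7) (# 5) (# 6) (# 4)
  ∷ entry (# 8 , # 9 , # 10) (# 8) (# 10) (# 9) (# 3) (# 2)
  ∷ entry (# 10 , # 11 , # 12) (# 10) (# 11) (# 12) (# 3) (# 3)
  ∷ entry (# 11 , # 12 , # 13) (# 11) (# 12) (# 13) (# 3) (# 2)
  ∷ entry (# 13 , # 14 , # 15) (# 14) (# 15) (# 13) (# 6) (# 4)
  ∷ entry (# 17 , # 0 , # 9) (# 17) (# 0) (# 9) (# 3) (# 2)
  ∷ entry (# 17 , # 1 , # 9) (# 17) (# 1) (# 9) (# 3) (# 2)
  ∷ [])

p-01-20 : PairRecipe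
p-01-20 = pairRecipe (# 0 , # 1) (# 2 , # 0)
  ( entry (# 2 , # 3 , # 4) (# 3) (# 4) (# 2) (# 3) (# 2)
  ∷ entry (# 3 , # 4 , # 5) (# 3) (# 4) (# 5) (# 3) (# 2)
  ∷ entry (# 5 , # 6 , # 7) (# 6) (# 7) (# 5) (# 6) (# 4)
  ∷ entry (# 10 , # 11 , # 12) (# 10) (# 11) (# 12) (# 6) (# 6)
  ∷ entry (# 13 , # 14 , # 15) (# 13) (# 14) (# 15) (# 6) (# 6)
  ∷ entry (# 17 , # 2 , # 8) (# 17) (# 8) (# 2) (# 6) (# 4)
  ∷ entry (# 16 , # 0 , # 9) (# 16) (# 0) (# 9) (# 6) (# 6)
  ∷ [])

p-11-20 : PairRecipe
p-11-20 = pairRecipe (# 1 , # 1) (# 2 , # 0)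
  ( entry (# 2 , # 3 , # 4) (# 3) (# 4) (# 2) (# 3) (# 2)
  ∷ entry (# 3 , # 4 , # 5) (# 3) (# 4) (# 5) (# 3) (# 2)
  ∷ entry (# 5 , # 6 , # 7) (# 6) (# 7) (# 5) (# 6) (# 4)
  ∷ entry (# 10 , # 11 , # 12) (# 10) (# 11) (# 12) (# 6) (# 6)
  ∷ entry (# 13 , # 14 , # 15) (# 13) (# 14) (# 15) (# 6) (# 6)
  ∷ entry (# 17 , # 2 , # 8) (# 17) (# 8) (# 2) (# 6) (# 4)
  ∷ entry (# 16 , # 1 , # 9) (# 16) (# 1) (# 9) (# 6) (# 6)
  ∷ [])

p-00-10 : PairRecipe
p-00-10 = pairRecipe (# 0 , # 0) (# 1 , # 0)
  ( entry (# 0 , # 1 , # 2) (# 0) (# 1) (# 2) (# 3) (# 2)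
  ∷ entry (# 2 , # 3 , # 4) (# 2) (# 3) (# 4) (# 4) (# 4)
  ∷ entry (# 3 , # 4 , # 5) (# 3) (# 4) (# 5) (# 2) (# 2)
  ∷ entry (# 5 , # 6 , # 7) (# 6) (# 7) (# 5) (# 6) (# 4)
  ∷ entry (# 8 , # 9 , # 10) (# 9) (# 10) (# 8) (# 3) (# 2)
  ∷ entry (# 10 , # 11 , # 12) (# 10) (# 11) (# 12) (# 3) (# 3)
  ∷ entry (# 11 , # 12 , # 13) (# 11) (# 12) (# 13) (# 3) (# 2)
  ∷ entry (# 13 , # 14 , # 15) (# 14) (# 15) (# 13) (# 6) (# 4)
  ∷ entry (# 17 , # 0 , # 8) (# 17) (# 0) (# 8) (# 3) (# 2)
  ∷ entry (# 17 , # 1 , # 8) (# 17) (# 1) (# 8) (# 3) (# 2)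
  ∷ [])

p-00-21 : PairRecipe
p-00-21 = pairRecipe (# 0 , # 0) (# 2 , # 1)
  ( entry (# 2 , # 3 , # 4) (# 3) (# 4) (# 2) (# 3) (# 2)
  ∷ entry (# 3 , # 4 , # 5) (# 3) (# 4) (# 5) (# 3) (# 2)
  ∷ entry (# 5 , # 6 , # 7) (# 6) (# 7) (# 5) (# 6) (# 4)
  ∷ entry (# 10 , # 11 , # 12) (# 10) (# 11) (# 12) (# 6) (# 6)
  ∷ entry (# 13 , # 14 , # 15) (# 13) (# 14) (# 15) (# 6) (# 6)
  ∷ entry (# 17 , # 2 , # 9) (# 17) (# 9) (# 2) (# 6) (# 4)
  ∷ entry (# 16 , # 0 , # 8) (# 16) (# 0) (# 8) (# 6) (# 6)
  ∷ [])

p-10-21 : PairRecipe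
p-10-21 = pairRecipe (# 1 , # 0) (# 2 , # 1)
  ( entry (# 2 , # 3 , # 4) (# 3) (# 4) (# 2) (# 3) (# 2)
  ∷ entry (# 3 , # 4 , # 5) (# 3) (# 4) (# 5) (# 3) (# 2)
  ∷ entry (# 5 , # 6 , # 7) (# 6) (# 7) (# 5) (# 6) (# 4)
  ∷ entry (# 10 , # 11 , # 12) (# 10) (# 11) (# 12) (# 6) (# 6)
  ∷ entry (# 13 , # 14 , # 15) (# 13) (# 14) (# 15) (# 6) (# 6)
  ∷ entry (# 17 , # 2 , # 9) (# 17) (# 9) (# 2) (# 6) (# 4)
  ∷ entry (# 16 , # 1 , # 8) (# 16) (# 1) (# 8) (# 6) (# 6)
  ∷ [])

p-02-13 : PairRecipe
p-02-13 = pairRecipe (# 0 , # 2) (# 1 , # 3)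
  ( entry (# 0 , # 1 , # 2) (# 0) (# 2) (# 1) (# 3) (# 2)
  ∷ entry (# 2 , # 3 , # 4) (# 2) (# 3) (# 4) (# 3) (# 3)
  ∷ entry (# 3 , # 4 , # 5) (# 3) (# 4) (# 5) (# 3) (# 2)
  ∷ entry (# 5 , # 6 , # 7) (# 6) (# 7) (# 5) (# 6) (# 4)
  ∷ entry (# 8 , # 9 , # 10) (# 8) (# 9) (# 10) (# 6) (# 4)
  ∷ entry (# 11 , # 12 , # 13) (# 11) (# 12) (# 13) (# 3) (# 2)
  ∷ entry (# 13 , # 14 , # 15) (# 14) (# 15) (# 13) (# 6) (# 4)
  ∷ entry (# 17 , # 0 , # 10) (# 17) (# 0) (# 10) (# 3) (# 2)
  ∷ entry (# 16 , # 1 , # 11) (# 16) (# 1) (# 11) (# 4) (# 3)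
  ∷ [])

p-02-14 : PairRecipe
p-02-14 = pairRecipe (# 0 , # 2) (# 1 , # 4)
  ( entry (# 0 , # 1 , # 2) (# 0) (# 2) (# 1) (# 3) (# 2)
  ∷ entry (# 2 , # 3 , # 4) (# 2) (# 3) (# 4) (# 3) (# 3)
  ∷ entry (# 3 , # 4 , # 5) (# 3) (# 4) (# 5) (# 3) (# 2)
  ∷ entry (# 5 , # 6 , # 7) (# 6) (# 7) (# 5) (# 6) (# 4)
  ∷ entry (# 8 , # 9 , # 10) (# 8) (# 9) (# 10) (# 6) (# 4)
  ∷ entry (# 11 , # 12 , # 13) (# 11) (# 12) (# 13) (# 3) (# 2)
  ∷ entry (# 13 , # 14 , # 15) (# 14) (# 15) (# 13) (# 6) (# 4)
  ∷ entry (# 17 , # 0 , # 10) (# 17) (# 0) (# 10) (# 3) (# 2)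
  ∷ entry (# 16 , # 1 , # 12) (# 16) (# 1) (# 12) (# 4) (# 3)
  ∷ [])

p-13-14 : PairRecipe
p-13-14 = pairRecipe (# 1 , # 3) (# 1 , # 4)
  ( entry (# 0 , # 1 , # 2) (# 0) (# 2) (# 1) (# 3) (# 2)
  ∷ entry (# 2 , # 3 , # 4) (# 2) (# 3) (# 4) (# 3) (# 3)
  ∷ entry (# 3 , # 4 , # 5) (# 3) (# 4) (# 5) (# 3) (# 2)
  ∷ entry (# 5 , # 6 , # 7) (# 6) (# 7) (# 5) (# 6) (# 4)
  ∷ entry (# 8 , # 9 , # 10) (# 8) (# 9) (# 10) (# 6) (# 4)
  ∷ entry (# 10 , # 11 , # 12) (# 11) (# 12) (# 10) (# 3) (# 2)
  ∷ entry (# 13 , # 14 , # 15) (# 13) (# 14) (# 15) (# 6) (# 6)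
  ∷ entry (# 17 , # 1 , # 11) (# 17) (# 11) (# 1) (# 3) (# 2)
  ∷ entry (# 17 , # 1 , # 12) (# 17) (# 12) (# 1) (# 3) (# 2)
  ∷ [])

p-03-04 : PairRecipe
p-03-04 = pairRecipe (# 0 , # 3) (# 0 , # 4)
  ( entry (# 0 , # 1 , # 2) (# 1) (# 2) (# 0) (# 3) (# 2)
  ∷ entry (# 2 , # 3 , # 4) (# 2) (# 3) (# 4) (# 3) (# 3)
  ∷ entry (# 3 , # 4 , # 5) (# 3) (# 4) (# 5) (# 3) (# 2)
  ∷ entry (# 5 , # 6 , # 7) (# 6) (# 7) (# 5) (# 6) (# 4)
  ∷ entry (# 8 , # 9 , # 10) (# 8) (# 9) (# 10) (# 6) (# 4)
  ∷ entry (# 10 , # 11 , # 12) (# 11) (# 12) (# 10) (# 3) (# 2)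
  ∷ entry (# 13 , # 14 , # 15) (# 13) (# 14) (# 15) (# 6) (# 6)
  ∷ entry (# 17 , # 0 , # 11) (# 17) (# 11) (# 0) (# 3) (# 2)
  ∷ entry (# 17 , # 0 , # 12) (# 17) (# 12) (# 0) (# 3) (# 2)
  ∷ [])

p-03-12 : PairRecipe
p-03-12 = pairRecipe (# 0 , # 3) (# 1 , # 2)
  ( entry (# 0 , # 1 , # 2) (# 1) (# 2) (# 0) (# 3) (# 2)
  ∷ entry (# 2 , # 3 , # 4) (# 2) (# 3) (# 4) (# 3) (# 3)
  ∷ entry (# 3 , # 4 , # 5) (# 3) (# 4) (# 5) (# 3) (# 2)
  ∷ entry (# 5 , # 6 , # 7) (# 6) (# 7) (# 5) (# 6) (# 4)
  ∷ entry (# 8 , # 9 , # 10) (# 8) (# 9) (# 10) (# 6) (# 4)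
  ∷ entry (# 11 , # 12 , # 13) (# 11) (# 12) (# 13) (# 3) (# 2)
  ∷ entry (# 13 , # 14 , # 15) (# 14) (# 15) (# 13) (# 6) (# 4)
  ∷ entry (# 17 , # 1 , # 10) (# 17) (# 1) (# 10) (# 3) (# 2)
  ∷ entry (# 16 , # 0 , # 11) (# 16) (# 0) (# 11) (# 4) (# 3)
  ∷ [])

p-04-12 : PairRecipe
p-04-12 = pairRecipe (# 0 , # 4) (# 1 , # 2)
  ( entry (# 0 , # 1 , # 2) (# 1) (# 2) (# 0) (# 3) (# 2)
  ∷ entry (# 2 , # 3 , # 4) (# 2) (# 3) (# 4) (# 3) (# 3)
  ∷ entry (# 3 , # 4 , # 5) (# 3) (# 4) (# 5) (# 3) (# 2)
  ∷ entry (# 5 , # 6 , # 7) (# 6) (# 7) (# 5) (# 6) (# 4)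
  ∷ entry (# 8 , # 9 , # 10) (# 8) (# 9) (# 10) (# 6) (# 4)
  ∷ entry (# 11 , # 12 , # 13) (# 11) (# 12) (# 13) (# 3) (# 2)
  ∷ entry (# 13 , # 14 , # 15) (# 14) (# 15) (# 13) (# 6) (# 4)
  ∷ entry (# 17 , # 1 , # 10) (# 17) (# 1) (# 10) (# 3) (# 2)
  ∷ entry (# 16 , # 0 , # 12) (# 16) (# 0) (# 12) (# 4) (# 3)
  ∷ [])

p-05-16 : PairRecipe
p-05-16 = pairRecipe (# 0 , # 5) (# 1 , # 6)
  ( entry (# 2 , # 3 , # 4) (# 2) (# 3) (# 4) (# 6) (# 6)
  ∷ entry (# 5 , # 6 , # 7) (# 5) (# 6) (# 7) (# 6) (# 6)
  ∷ entry (# 8 , # 9 , # 10) (# 8) (# 9) (# 10) (# 6) (# 4)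
  ∷ entry (# 10 , # 11 , # 12) (# 11) (# 12) (# 10) (# 3) (# 2)
  ∷ entry (# 11 , # 12 , # 13) (# 11) (# 12) (# 13) (# 3) (# 2)
  ∷ entry (# 17 , # 0 , # 13) (# 17) (# 0) (# 13) (# 6) (# 4)
  ∷ entry (# 16 , # 1 , # 14) (# 16) (# 1) (# 14) (# 6) (# 6)
  ∷ [])

p-05-17 : PairRecipe
p-05-17 = pairRecipe (# 0 , # 5) (# 1 , # 7)
  ( entry (# 2 , # 3 , # 4) (# 2) (# 3) (# 4) (# 6) (# 6)
  ∷ entry (# 5 , # 6 , # 7) (# 5) (# 6) (# 7) (# 6) (# 6)
  ∷ entry (# 8 , # 9 , # 10) (# 8) (# 9) (# 10) (# 6) (# 4)
  ∷ entry (# 10 , # 11 , # 12) (# 11) (# 12) (# 10) (# 3) (# 2)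
  ∷ entry (# 11 , # 12 , # 13) (# 11) (# 12) (# 13) (# 3) (# 2)
  ∷ entry (# 17 , # 0 , # 13) (# 17) (# 0) (# 13) (# 6) (# 4)
  ∷ entry (# 16 , # 1 , # 15) (# 16) (# 1) (# 15) (# 6) (# 6)
  ∷ [])

p-16-17 : PairRecipe
p-16-17 = pairRecipe (# 1 , # 6) (# 1 , # 7)
  ( entry (# 0 , # 1 , # 2) (# 0) (# 2) (# 1) (# 3) (# 2)
  ∷ entry (# 2 , # 3 , # 4) (# 2) (# 3) (# 4) (# 3) (# 3)
  ∷ entry (# 3 , # 4 , # 5) (# 3) (# 4) (# 5) (# 3) (# 2)
  ∷ entry (# 5 , # 6 , # 7) (# 6) (# 7) (# 5) (# 6) (# 4)
  ∷ entry (# 8 , # 9 , # 10) (# 8) (# 9) (# 10) (# 6) (# 4)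
  ∷ entry (# 10 , # 11 , # 12) (# 10) (# 11) (# 12) (# 2) (# 2)
  ∷ entry (# 11 , # 12 , # 13) (# 11) (# 12) (# 13) (# 4) (# 3)
  ∷ entry (# 13 , # 14 , # 15) (# 13) (# 14) (# 15) (# 3) (# 3)
  ∷ entry (# 17 , # 1 , # 14) (# 17) (# 14) (# 1) (# 3) (# 2)
  ∷ entry (# 17 , # 1 , # 15) (# 17) (# 15) (# 1) (# 3) (# 2)
  ∷ [])

p-06-07 : PairRecipe
p-06-07 = pairRecipe (# 0 , # 6) (# 0 , # 7)
  ( entry (# 0 , # 1 , # 2) (# 1) (# 2) (# 0) (# 3) (# 2)
  ∷ entry (# 2 , # 3 , # 4) (# 2) (# 3) (# 4) (# 3) (# 3)
  ∷ entry (# 3 , # 4 , # 5) (# 3) (# 4) (# 5) (# 3) (# 2)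
  ∷ entry (# 5 , # 6 , # 7) (# 6) (# 7) (# 5) (# 6) (# 4)
  ∷ entry (# 8 , # 9 , # 10) (# 8) (# 9) (# 10) (# 6) (# 4)
  ∷ entry (# 10 , # 11 , # 12) (# 10) (# 11) (# 12) (# 2) (# 2)
  ∷ entry (# 11 , # 12 , # 13) (# 11) (# 12) (# 13) (# 4) (# 3)
  ∷ entry (# 13 , # 14 , # 15) (# 13) (# 14) (# 15) (# 3) (# 3)
  ∷ entry (# 17 , # 0 , # 14) (# 17) (# 14) (# 0) (# 3) (# 2)
  ∷ entry (# 17 , # 0 , # 15) (# 17) (# 15) (# 0) (# 3) (# 2)
  ∷ [])

p-06-15 : PairRecipe
p-06-15 = pairRecipe (# 0 , # 6) (# 1 , # 5)
  ( entry (# 2 , # 3 , # 4) (# 2) (# 3) (# 4) (# 6) (# 6)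
  ∷ entry (# 5 , # 6 , # 7) (# 5) (# 6) (# 7) (# 6) (# 6)
  ∷ entry (# 8 , # 9 , # 10) (# 8) (# 9) (# 10) (# 6) (# 4)
  ∷ entry (# 10 , # 11 , # 12) (# 11) (# 12) (# 10) (# 3) (# 2)
  ∷ entry (# 11 , # 12 , # 13) (# 11) (# 12) (# 13) (# 3) (# 2)
  ∷ entry (# 17 , # 1 , # 13) (# 17) (# 1) (# 13) (# 6) (# 4)
  ∷ entry (# 16 , # 0 , # 14) (# 16) (# 0) (# 14) (# 6) (# 6)
  ∷ [])

p-07-15 : PairRecipe
p-07-15 = pairRecipe (# 0 , # 7) (# 1 , # 5)
  ( entry (# 2 , # 3 , # 4) (# 2) (# 3) (# 4) (# 6) (# 6)
  ∷ entry (# 5 , # 6 , # 7) (# 5) (# 6) (# 7) (# 6) (# 6)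
  ∷ entry (# 8 , # 9 , # 10) (# 8) (# 9) (# 10) (# 6) (# 4)
  ∷ entry (# 10 , # 11 , # 12) (# 11) (# 12) (# 10) (# 3) (# 2)
  ∷ entry (# 11 , # 12 , # 13) (# 11) (# 12) (# 13) (# 3) (# 2)
  ∷ entry (# 17 , # 1 , # 13) (# 17) (# 1) (# 13) (# 6) (# 4)
  ∷ entry (# 16 , # 0 , # 15) (# 16) (# 0) (# 15) (# 6) (# 6)
  ∷ [])

p-23-34 : PairRecipe
p-23-34 = pairRecipe (# 2 , # 3) (# 3 , # 4)
  ( entry (# 0 , # 1 , # 2) (# 0) (# 1) (# 2) (# 6) (# 4)
  ∷ entry (# 3 , # 4 , # 5) (# 3) (# 4) (# 5) (# 3) (# 2)
  ∷ entry (# 5 , # 6 , # 7) (# 6) (# 7) (# 5) (# 6) (# 4)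
  ∷ entry (# 8 , # 9 , # 10) (# 8) (# 9) (# 10) (# 6) (# 4)
  ∷ entry (# 10 , # 11 , # 12) (# 11) (# 12) (# 10) (# 3) (# 2)
  ∷ entry (# 13 , # 14 , # 15) (# 13) (# 14) (# 15) (# 6) (# 6)
  ∷ entry (# 17 , # 2 , # 11) (# 17) (# 11) (# 2) (# 3) (# 2)
  ∷ entry (# 17 , # 3 , # 12) (# 17) (# 3) (# 12) (# 3) (# 3)
  ∷ [])

p-23-44 : PairRecipe
p-23-44 = pairRecipe (# 2 , # 3) (# 4 , # 4)
  ( entry (# 0 , # 1 , # 2) (# 0) (# 1) (# 2) (# 6) (# 4)
  ∷ entry (# 3 , # 4 , # 5) (# 3) (# 4) (# 5) (# 3) (# 2)
  ∷ entry (# 5 , # 6 , # 7) (# 6) (# 7) (# 5) (# 6) (# 4)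
  ∷ entry (# 8 , # 9 , # 10) (# 8) (# 9) (# 10) (# 6) (# 4)
  ∷ entry (# 10 , # 11 , # 12) (# 11) (# 12) (# 10) (# 3) (# 2)
  ∷ entry (# 13 , # 14 , # 15) (# 13) (# 14) (# 15) (# 6) (# 6)
  ∷ entry (# 17 , # 2 , # 11) (# 17) (# 11) (# 2) (# 3) (# 2)
  ∷ entry (# 17 , # 4 , # 12) (# 17) (# 4) (# 12) (# 3) (# 3)
  ∷ [])

p-34-44 : PairRecipe
p-34-44 = pairRecipe (# 3 , # 4) (# 4 , # 4)
  ( entry (# 0 , # 1 , # 2) (# 0) (# 1) (# 2) (# 6) (# 4)
  ∷ entry (# 2 , # 3 , # 4) (# 3) (# 4) (# 2) (# 3) (# 2)
  ∷ entry (# 5 , # 6 , # 7) (# 5) (# 6) (# 7) (# 6) (# 6)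
  ∷ entry (# 8 , # 9 , # 10) (# 8) (# 9) (# 10) (# 6) (# 4)
  ∷ entry (# 10 , # 11 , # 12) (# 10) (# 11) (# 12) (# 2) (# 2)
  ∷ entry (# 13 , # 14 , # 15) (# 13) (# 14) (# 15) (# 6) (# 6)
  ∷ entry (# 17 , # 3 , # 12) (# 17) (# 3) (# 12) (# 3) (# 2)
  ∷ entry (# 17 , # 4 , # 12) (# 17) (# 4) (# 12) (# 3) (# 2)
  ∷ [])

p-24-33 : PairRecipe
p-24-33 = pairRecipe (# 2 , # 4) (# 3 , # 3)
  ( entry (# 0 , # 1 , # 2) (# 0) (# 1) (# 2) (# 6) (# 4)
  ∷ entry (# 3 , # 4 , # 5) (# 3) (# 4) (# 5) (# 3) (# 2)
  ∷ entry (# 5 , # 6 , # 7) (# 6) (# 7) (# 5) (# 6) (# 4)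
  ∷ entry (# 8 , # 9 , # 10) (# 8) (# 9) (# 10) (# 6) (# 4)
  ∷ entry (# 10 , # 11 , # 12) (# 11) (# 12) (# 10) (# 3) (# 2)
  ∷ entry (# 13 , # 14 , # 15) (# 13) (# 14) (# 15) (# 6) (# 6)
  ∷ entry (# 17 , # 2 , # 12) (# 17) (# 12) (# 2) (# 3) (# 2)
  ∷ entry (# 17 , # 3 , # 11) (# 17) (# 3) (# 11) (# 3) (# 3)
  ∷ [])

p-24-43 : PairRecipe
p-24-43 = pairRecipe (# 2 , # 4) (# 4 , # 3)
  ( entry (# 0 , # 1 , # 2) (# 0) (# 1) (# 2) (# 6) (# 4)
  ∷ entry (# 3 , # 4 , # 5) (# 3) (# 4) (# 5) (# 3) (# 2)
  ∷ entry (# 5 , # 6 , # 7) (# 6) (# 7) (# 5) (# 6) (# 4)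
  ∷ entry (# 8 , # 9 , # 10) (# 8) (# 9) (# 10) (# 6) (# 4)
  ∷ entry (# 10 , # 11 , # 12) (# 11) (# 12) (# 10) (# 3) (# 2)
  ∷ entry (# 13 , # 14 , # 15) (# 13) (# 14) (# 15) (# 6) (# 6)
  ∷ entry (# 17 , # 2 , # 12) (# 17) (# 12) (# 2) (# 3) (# 2)
  ∷ entry (# 17 , # 4 , # 11) (# 17) (# 4) (# 11) (# 3) (# 3)
  ∷ [])

p-33-43 : PairRecipe
p-33-43 = pairRecipe (# 3 , # 3) (# 4 , # 3)
  ( entry (# 0 , # 1 , # 2) (# 0) (# 1) (# 2) (# 6) (# 4)
  ∷ entry (# 2 , # 3 , # 4) (# 3) (# 4) (# 2) (# 3) (# 2)
  ∷ entry (# 5 , # 6 , # 7) (# 5) (# 6) (# 7) (# 6) (# 6)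
  ∷ entry (# 8 , # 9 , # 10) (# 8) (# 9) (# 10) (# 6) (# 4)
  ∷ entry (# 10 , # 11 , # 12) (# 10) (# 11) (# 12) (# 2) (# 2)
  ∷ entry (# 13 , # 14 , # 15) (# 13) (# 14) (# 15) (# 6) (# 6)
  ∷ entry (# 17 , # 3 , # 11) (# 17) (# 3) (# 11) (# 3) (# 2)
  ∷ entry (# 17 , # 4 , # 11) (# 17) (# 4) (# 11) (# 3) (# 2)
  ∷ [])

p-32-40 : PairRecipe
p-32-40 = pairRecipe (# 3 , # 2) (# 4 , # 0)
  ( entry (# 0 , # 1 , # 2) (# 0) (# 1) (# 2) (# 6) (# 6)
  ∷ entry (# 5 , # 6 , # 7) (# 5) (# 6) (# 7) (# 6) (# 6)
  ∷ entry (# 10 , # 11 , # 12) (# 11) (# 12) (# 10) (# 3) (# 2)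
  ∷ entry (# 11 , # 12 , # 13) (# 11) (# 12) (# 13) (# 3) (# 2)
  ∷ entry (# 13 , # 14 , # 15) (# 14) (# 15) (# 13) (# 6) (# 4)
  ∷ entry (# 17 , # 3 , # 10) (# 17) (# 3) (# 10) (# 6) (# 4)
  ∷ entry (# 16 , # 4 , # 8) (# 16) (# 4) (# 8) (# 6) (# 6)
  ∷ [])

p-32-41 : PairRecipe
p-32-41 = pairRecipe (# 3 , # 2) (# 4 , # 1)
  ( entry (# 0 , # 1 , # 2) (# 0) (# 1) (# 2) (# 6) (# 6)
  ∷ entry (# 5 , # 6 , # 7) (# 5) (# 6) (# 7) (# 6) (# 6)
  ∷ entry (# 10 , # 11 , # 12) (# 11) (# 12) (# 10) (# 3) (# 2)
  ∷ entry (# 11 , # 12 , # 13) (# 11) (# 12) (# 13) (# 3) (# 2)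
  ∷ entry (# 13 , # 14 , # 15) (# 14) (# 15) (# 13) (# 6) (# 4)
  ∷ entry (# 17 , # 3 , # 10) (# 17) (# 3) (# 10) (# 6) (# 4)
  ∷ entry (# 16 , # 4 , # 9) (# 16) (# 4) (# 9) (# 6) (# 6)
  ∷ [])

p-40-41 : PairRecipe
p-40-41 = pairRecipe (# 4 , # 0) (# 4 , # 1)
  ( entry (# 0 , # 1 , # 2) (# 0) (# 1) (# 2) (# 6) (# 4)
  ∷ entry (# 2 , # 3 , # 4) (# 2) (# 3) (# 4) (# 2) (# 2)
  ∷ entry (# 5 , # 6 , # 7) (# 5) (# 6) (# 7) (# 6) (# 6)
  ∷ entry (# 8 , # 9 , # 10) (# 8) (# 9) (# 10) (# 3) (# 2)
  ∷ entry (# 10 , # 11 , # 12) (# 10) (# 11) (# 12) (# 4) (# 4)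
  ∷ entry (# 11 , # 12 , # 13) (# 11) (# 12) (# 13) (# 2) (# 2)
  ∷ entry (# 13 , # 14 , # 15) (# 14) (# 15) (# 13) (# 6) (# 4)
  ∷ entry (# 17 , # 4 , # 8) (# 17) (# 8) (# 4) (# 3) (# 2)
  ∷ entry (# 17 , # 4 , # 9) (# 17) (# 9) (# 4) (# 3) (# 2)
  ∷ [])

p-30-31 : PairRecipe
p-30-31 = pairRecipe (# 3 , # 0) (# 3 , # 1)
  ( entry (# 0 , # 1 , # 2) (# 0) (# 1) (# 2) (# 6) (# 4)
  ∷ entry (# 2 , # 3 , # 4) (# 2) (# 3) (# 4) (# 2) (# 2)
  ∷ entry (# 5 , # 6 , # 7) (# 5) (# 6) (# 7) (# 6) (# 6)
  ∷ entry (# 8 , # 9 , # 10) (# 8) (# 9) (# 10) (# 3) (# 2)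
  ∷ entry (# 10 , # 11 , # 12) (# 10) (# 11) (# 12) (# 4) (# 4)
  ∷ entry (# 11 , # 12 , # 13) (# 11) (# 12) (# 13) (# 2) (# 2)
  ∷ entry (# 13 , # 14 , # 15) (# 14) (# 15) (# 13) (# 6) (# 4)
  ∷ entry (# 17 , # 3 , # 8) (# 17) (# 8) (# 3) (# 3) (# 2)
  ∷ entry (# 17 , # 3 , # 9) (# 17) (# 9) (# 3) (# 3) (# 2)
  ∷ [])

p-30-42 : PairRecipe
p-30-42 = pairRecipe (# 3 , # 0) (# 4 , # 2)
  ( entry (# 0 , # 1 , # 2) (# 0) (# 1) (# 2) (# 6) (# 6)
  ∷ entry (# 5 , # 6 , # 7) (# 5) (# 6) (# 7) (# 6) (# 6)
  ∷ entry (# 10 , # 11 , # 12) (# 11) (# 12) (# 10) (# 3) (# 2)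
  ∷ entry (# 11 , # 12 , # 13) (# 11) (# 12) (# 13) (# 3) (# 2)
  ∷ entry (# 13 , # 14 , # 15) (# 14) (# 15) (# 13) (# 6) (# 4)
  ∷ entry (# 17 , # 4 , # 10) (# 17) (# 4) (# 10) (# 6) (# 4)
  ∷ entry (# 16 , # 3 , # 8) (# 16) (# 3) (# 8) (# 6) (# 6)
  ∷ [])

p-31-42 : PairRecipe
p-31-42 = pairRecipe (# 3 , # 1) (# 4 , # 2)
  ( entry (# 0 , # 1 , # 2) (# 0) (# 1) (# 2) (# 6) (# 6)
  ∷ entry (# 5 , # 6 , # 7) (# 5) (# 6) (# 7) (# 6) (# 6)
  ∷ entry (# 10 , # 11 , # 12) (# 11) (# 12) (# 10) (# 3) (# 2)
  ∷ entry (# 11 , # 12 , # 13) (# 11) (# 12) (# 13) (# 3) (# 2)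
  ∷ entry (# 13 , # 14 , # 15) (# 14) (# 15) (# 13) (# 6) (# 4)
  ∷ entry (# 17 , # 4 , # 10) (# 17) (# 4) (# 10) (# 6) (# 4)
  ∷ entry (# 16 , # 3 , # 9) (# 16) (# 3) (# 9) (# 6) (# 6)
  ∷ [])

p-35-46 : PairRecipe
p-35-46 = pairRecipe (# 3 , # 5) (# 4 , # 6)
  ( entry (# 0 , # 1 , # 2) (# 0) (# 1) (# 2) (# 6) (# 6)
  ∷ entry (# 5 , # 6 , # 7) (# 5) (# 6) (# 7) (# 6) (# 6)
  ∷ entry (# 8 , # 9 , # 10) (# 8) (# 9) (# 10) (# 6) (# 4)
  ∷ entry (# 10 , # 11 , # 12) (# 11) (# 12) (# 10) (# 3) (# 2)
  ∷ entry (# 11 , # 12 , # 13) (# 11) (# 12) (# 13) (# 3) (# 2)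
  ∷ entry (# 17 , # 3 , # 13) (# 17) (# 3) (# 13) (# 6) (# 4)
  ∷ entry (# 16 , # 4 , # 14) (# 16) (# 4) (# 14) (# 6) (# 6)
  ∷ [])

p-35-47 : PairRecipe
p-35-47 = pairRecipe (# 3 , # 5) (# 4 , # 7)
  ( entry (# 0 , # 1 , # 2) (# 0) (# 1) (# 2) (# 6) (# 6)
  ∷ entry (# 5 , # 6 , # 7) (# 5) (# 6) (# 7) (# 6) (# 6)
  ∷ entry (# 8 , # 9 , # 10) (# 8) (# 9) (# 10) (# 6) (# 4)
  ∷ entry (# 10 , # 11 , # 12) (# 11) (# 12) (# 10) (# 3) (# 2)
  ∷ entry (# 11 , # 12 , # 13) (# 11) (# 12) (# 13) (# 3) (# 2)
  ∷ entry (# 17 , # 3 , # 13) (# 17) (# 3) (# 13) (# 6) (# 4)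
  ∷ entry (# 16 , # 4 , # 15) (# 16) (# 4) (# 15) (# 6) (# 6)
  ∷ [])

p-46-47 : PairRecipe
p-46-47 = pairRecipe (# 4 , # 6) (# 4 , # 7)
  ( entry (# 0 , # 1 , # 2) (# 0) (# 1) (# 2) (# 6) (# 4)
  ∷ entry (# 2 , # 3 , # 4) (# 2) (# 3) (# 4) (# 2) (# 2)
  ∷ entry (# 5 , # 6 , # 7) (# 5) (# 6) (# 7) (# 6) (# 6)
  ∷ entry (# 8 , # 9 , # 10) (# 8) (# 9) (# 10) (# 6) (# 4)
  ∷ entry (# 10 , # 11 , # 12) (# 10) (# 11) (# 12) (# 2) (# 2)
  ∷ entry (# 11 , # 12 , # 13) (# 11) (# 12) (# 13) (# 4) (# 3)
  ∷ entry (# 13 , # 14 , # 15) (# 13) (# 14) (# 15) (# 3) (# 3)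
  ∷ entry (# 17 , # 4 , # 14) (# 17) (# 14) (# 4) (# 3) (# 2)
  ∷ entry (# 17 , # 4 , # 15) (# 17) (# 15) (# 4) (# 3) (# 2)
  ∷ [])

p-36-37 : PairRecipe
p-36-37 = pairRecipe (# 3 , # 6) (# 3 , # 7)
  ( entry (# 0 , # 1 , # 2) (# 0) (# 1) (# 2) (# 6) (# 4)
  ∷ entry (# 2 , # 3 , # 4) (# 2) (# 3) (# 4) (# 2) (# 2)
  ∷ entry (# 5 , # 6 , # 7) (# 5) (# 6) (# 7) (# 6) (# 6)
  ∷ entry (# 8 , # 9 , # 10) (# 8) (# 9) (# 10) (# 6) (# 4)
  ∷ entry (# 10 , # 11 , # 12) (# 10) (# 11) (# 12) (# 2) (# 2)
  ∷ entry (# 11 , # 12 , # 13) (# 11) (# 12) (# 13) (# 4) (# 3)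
  ∷ entry (# 13 , # 14 , # 15) (# 13) (# 14) (# 15) (# 3) (# 3)
  ∷ entry (# 17 , # 3 , # 14) (# 17) (# 14) (# 3) (# 3) (# 2)
  ∷ entry (# 17 , # 3 , # 15) (# 17) (# 15) (# 3) (# 3) (# 2)
  ∷ [])

p-36-45 : PairRecipe
p-36-45 = pairRecipe (# 3 , # 6) (# 4 , # 5)
  ( entry (# 0 , # 1 , # 2) (# 0) (# 1) (# 2) (# 6) (# 6)
  ∷ entry (# 5 , # 6 , # 7) (# 5) (# 6) (# 7) (# 6) (# 6)
  ∷ entry (# 8 , # 9 , # 10) (# 8) (# 9) (# 10) (# 6) (# 4)
  ∷ entry (# 10 , # 11 , # 12) (# 11) (# 12) (# 10) (# 3) (# 2)
  ∷ entry (# 11 , # 12 , # 13) (# 11) (# 12) (# 13) (# 3) (# 2)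
  ∷ entry (# 17 , # 4 , # 13) (# 17) (# 4) (# 13) (# 6) (# 4)
  ∷ entry (# 16 , # 3 , # 14) (# 16) (# 3) (# 14) (# 6) (# 6)
  ∷ [])

p-37-45 : PairRecipe
p-37-45 = pairRecipe (# 3 , # 7) (# 4 , # 5)
  ( entry (# 0 , # 1 , # 2) (# 0) (# 1) (# 2) (# 6) (# 6)
  ∷ entry (# 5 , # 6 , # 7) (# 5) (# 6) (# 7) (# 6) (# 6)
  ∷ entry (# 8 , # 9 , # 10) (# 8) (# 9) (# 10) (# 6) (# 4)
  ∷ entry (# 10 , # 11 , # 12) (# 11) (# 12) (# 10) (# 3) (# 2)
  ∷ entry (# 11 , # 12 , # 13) (# 11) (# 12) (# 13) (# 3) (# 2)
  ∷ entry (# 17 , # 4 , # 13) (# 17) (# 4) (# 13) (# 6) (# 4)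
  ∷ entry (# 16 , # 3 , # 15) (# 16) (# 3) (# 15) (# 6) (# 6)
  ∷ [])

p-26-67 : PairRecipe
p-26-67 = pairRecipe (# 2 , # 6) (# 6 , # 7)
  ( entry (# 0 , # 1 , # 2) (# 0) (# 1) (# 2) (# 6) (# 4)
  ∷ entry (# 3 , # 4 , # 5) (# 3) (# 4) (# 5) (# 6) (# 4)
  ∷ entry (# 5 , # 6 , # 7) (# 6) (# 7) (# 5) (# 3) (# 2)
  ∷ entry (# 8 , # 9 , # 10) (# 8) (# 9) (# 10) (# 6) (# 4)
  ∷ entry (# 10 , # 11 , # 12) (# 10) (# 11) (# 12) (# 2) (# 2)
  ∷ entry (# 11 , # 12 , # 13) (# 11) (# 12) (# 13) (# 4) (# 3)
  ∷ entry (# 13 , # 14 , # 15) (# 13) (# 14) (# 15) (# 3) (# 2)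
  ∷ entry (# 17 , # 2 , # 14) (# 17) (# 14) (# 2) (# 3) (# 2)
  ∷ entry (# 16 , # 6 , # 15) (# 16) (# 15) (# 6) (# 4) (# 3)
  ∷ [])

p-26-77 : PairRecipe
p-26-77 = pairRecipe (# 2 , # 6) (# 7 , # 7)
  ( entry (# 0 , # 1 , # 2) (# 0) (# 1) (# 2) (# 6) (# 4)
  ∷ entry (# 3 , # 4 , # 5) (# 3) (# 4) (# 5) (# 6) (# 4)
  ∷ entry (# 5 , # 6 , # 7) (# 6) (# 7) (# 5) (# 3) (# 2)
  ∷ entry (# 8 , # 9 , # 10) (# 8) (# 9) (# 10) (# 6) (# 4)
  ∷ entry (# 10 , # 11 , # 12) (# 10) (# 11) (# 12) (# 2) (# 2)
  ∷ entry (# 11 , # 12 , # 13) (# 11) (# 12) (# 13) (# 4) (# 3)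
  ∷ entry (# 13 , # 14 , # 15) (# 13) (# 14) (# 15) (# 3) (# 2)
  ∷ entry (# 17 , # 2 , # 14) (# 17) (# 14) (# 2) (# 3) (# 2)
  ∷ entry (# 16 , # 7 , # 15) (# 16) (# 15) (# 7) (# 4) (# 3)
  ∷ [])

p-67-77 : PairRecipe
p-67-77 = pairRecipe (# 6 , # 7) (# 7 , # 7)
  ( entry (# 0 , # 1 , # 2) (# 0) (# 1) (# 2) (# 6) (# 4)
  ∷ entry (# 2 , # 3 , # 4) (# 2) (# 3) (# 4) (# 2) (# 2)
  ∷ entry (# 3 , # 4 , # 5) (# 3) (# 4) (# 5) (# 4) (# 3)
  ∷ entry (# 5 , # 6 , # 7) (# 5) (# 6) (# 7) (# 3) (# 3)
  ∷ entry (# 8 , # 9 , # 10) (# 8) (# 9) (# 10) (# 6) (# 4)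
  ∷ entry (# 10 , # 11 , # 12) (# 10) (# 11) (# 12) (# 2) (# 2)
  ∷ entry (# 11 , # 12 , # 13) (# 11) (# 12) (# 13) (# 4) (# 3)
  ∷ entry (# 13 , # 14 , # 15) (# 13) (# 14) (# 15) (# 3) (# 2)
  ∷ entry (# 17 , # 6 , # 15) (# 17) (# 6) (# 15) (# 3) (# 2)
  ∷ entry (# 17 , # 7 , # 15) (# 17) (# 7) (# 15) (# 3) (# 2)
  ∷ [])

p-27-66 : PairRecipe
p-27-66 = pairRecipe (# 2 , # 7) (# 6 , # 6)
  ( entry (# 0 , # 1 , # 2) (# 0) (# 1) (# 2) (# 6) (# 4)
  ∷ entry (# 3 , # 4 , # 5) (# 3) (# 4) (# 5) (# 6) (# 4)
  ∷ entry (# 5 , # 6 , # 7) (# 6) (# 7) (# 5) (# 3) (# 2)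
  ∷ entry (# 8 , # 9 , # 10) (# 8) (# 9) (# 10) (# 6) (# 4)
  ∷ entry (# 10 , # 11 , # 12) (# 10) (# 11) (# 12) (# 2) (# 2)
  ∷ entry (# 11 , # 12 , # 13) (# 11) (# 12) (# 13) (# 4) (# 3)
  ∷ entry (# 13 , # 14 , # 15) (# 13) (# 15) (# 14) (# 3) (# 2)
  ∷ entry (# 17 , # 2 , # 15) (# 17) (# 15) (# 2) (# 3) (# 2)
  ∷ entry (# 16 , # 6 , # 14) (# 16) (# 14) (# 6) (# 4) (# 3)
  ∷ [])

p-27-76 : PairRecipe
p-27-76 = pairRecipe (# 2 , # 7) (# 7 , # 6)
  ( entry (# 0 , # 1 , # 2) (# 0) (# 1) (# 2) (# 6) (# 4)
  ∷ entry (# 3 , # 4 , # 5) (# 3) (# 4) (# 5) (# 6) (# 4)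
  ∷ entry (# 5 , # 6 , # 7) (# 6) (# 7) (# 5) (# 3) (# 2)
  ∷ entry (# 8 , # 9 , # 10) (# 8) (# 9) (# 10) (# 6) (# 4)
  ∷ entry (# 10 , # 11 , # 12) (# 10) (# 11) (# 12) (# 2) (# 2)
  ∷ entry (# 11 , # 12 , # 13) (# 11) (# 12) (# 13) (# 4) (# 3)
  ∷ entry (# 13 , # 14 , # 15) (# 13) (# 15) (# 14) (# 3) (# 2)
  ∷ entry (# 17 , # 2 , # 15) (# 17) (# 15) (# 2) (# 3) (# 2)
  ∷ entry (# 16 , # 7 , # 14) (# 16) (# 14) (# 7) (# 4) (# 3)
  ∷ [])

p-66-76 : PairRecipe
p-66-76 = pairRecipe (# 6 , # 6) (# 7 , # 6)
  ( entry (# 0 , # 1 , # 2) (# 0) (# 1) (# 2) (# 6) (# 4)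
  ∷ entry (# 2 , # 3 , # 4) (# 2) (# 3) (# 4) (# 2) (# 2)
  ∷ entry (# 3 , # 4 , # 5) (# 3) (# 4) (# 5) (# 4) (# 3)
  ∷ entry (# 5 , # 6 , # 7) (# 5) (# 6) (# 7) (# 3) (# 3)
  ∷ entry (# 8 , # 9 , # 10) (# 8) (# 9) (# 10) (# 6) (# 4)
  ∷ entry (# 10 , # 11 , # 12) (# 10) (# 11) (# 12) (# 2) (# 2)
  ∷ entry (# 11 , # 12 , # 13) (# 11) (# 12) (# 13) (# 4) (# 3)
  ∷ entry (# 13 , # 14 , # 15) (# 13) (# 15) (# 14) (# 3) (# 2)
  ∷ entry (# 17 , # 6 , # 14) (# 17) (# 6) (# 14) (# 3) (# 2)
  ∷ entry (# 17 , # 7 , # 14) (# 17) (# 7) (# 14) (# 3) (# 2)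
  ∷ [])

p-62-70 : PairRecipe
p-62-70 = pairRecipe (# 6 , # 2) (# 7 , # 0)
  ( entry (# 0 , # 1 , # 2) (# 0) (# 1) (# 2) (# 6) (# 6)
  ∷ entry (# 3 , # 4 , # 5) (# 3) (# 4) (# 5) (# 6) (# 6)
  ∷ entry (# 10 , # 11 , # 12) (# 11) (# 12) (# 10) (# 3) (# 2)
  ∷ entry (# 11 , # 12 , # 13) (# 11) (# 12) (# 13) (# 3) (# 2)
  ∷ entry (# 13 , # 14 , # 15) (# 14) (# 15) (# 13) (# 6) (# 4)
  ∷ entry (# 17 , # 6 , # 10) (# 17) (# 6) (# 10) (# 6) (# 4)
  ∷ entry (# 16 , # 7 , # 8) (# 16) (# 7) (# 8) (# 6) (# 6)
  ∷ [])

p-62-71 : PairRecipe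
p-62-71 = pairRecipe (# 6 , # 2) (# 7 , # 1)
  ( entry (# 0 , # 1 , # 2) (# 0) (# 1) (# 2) (# 6) (# 6)
  ∷ entry (# 3 , # 4 , # 5) (# 3) (# 4) (# 5) (# 6) (# 6)
  ∷ entry (# 10 , # 11 , # 12) (# 11) (# 12) (# 10) (# 3) (# 2)
  ∷ entry (# 11 , # 12 , # 13) (# 11) (# 12) (# 13) (# 3) (# 2)
  ∷ entry (# 13 , # 14 , # 15) (# 14) (# 15) (# 13) (# 6) (# 4)
  ∷ entry (# 17 , # 6 , # 10) (# 17) (# 6) (# 10) (# 6) (# 4)
  ∷ entry (# 16 , # 7 , # 9) (# 16) (# 7) (# 9) (# 6) (# 6)
  ∷ [])

p-70-71 : PairRecipe
p-70-71 = pairRecipe (# 7 , # 0) (# 7 , # 1)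
  ( entry (# 0 , # 1 , # 2) (# 0) (# 1) (# 2) (# 6) (# 4)
  ∷ entry (# 2 , # 3 , # 4) (# 2) (# 3) (# 4) (# 2) (# 2)
  ∷ entry (# 3 , # 4 , # 5) (# 3) (# 4) (# 5) (# 4) (# 3)
  ∷ entry (# 5 , # 6 , # 7) (# 5) (# 6) (# 7) (# 3) (# 2)
  ∷ entry (# 8 , # 9 , # 10) (# 8) (# 9) (# 10) (# 3) (# 2)
  ∷ entry (# 10 , # 11 , # 12) (# 10) (# 11) (# 12) (# 4) (# 4)
  ∷ entry (# 11 , # 12 , # 13) (# 11) (# 12) (# 13) (# 2) (# 2)
  ∷ entry (# 13 , # 14 , # 15) (# 14) (# 15) (# 13) (# 6) (# 4)
  ∷ entry (# 17 , # 7 , # 8) (# 17) (# 8) (# 7) (# 3) (# 2)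
  ∷ entry (# 17 , # 7 , # 9) (# 17) (# 9) (# 7) (# 3) (# 2)
  ∷ [])

p-60-61 : PairRecipe
p-60-61 = pairRecipe (# 6 , # 0) (# 6 , # 1)
  ( entry (# 0 , # 1 , # 2) (# 0) (# 1) (# 2) (# 6) (# 4)
  ∷ entry (# 2 , # 3 , # 4) (# 2) (# 3) (# 4) (# 2) (# 2)
  ∷ entry (# 3 , # 4 , # 5) (# 3) (# 4) (# 5) (# 4) (# 3)
  ∷ entry (# 5 , # 6 , # 7) (# 5) (# 7) (# 6) (# 3) (# 2)
  ∷ entry (# 8 , # 9 , # 10) (# 8) (# 9) (# 10) (# 3) (# 2)
  ∷ entry (# 10 , # 11 , # 12) (# 10) (# 11) (# 12) (# 4) (# 4)
  ∷ entry (# 11 , # 12 , # 13) (# 11) (# 12) (# 13) (# 2) (# 2)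
  ∷ entry (# 13 , # 14 , # 15) (# 14) (# 15) (# 13) (# 6) (# 4)
  ∷ entry (# 17 , # 6 , # 8) (# 17) (# 8) (# 6) (# 3) (# 2)
  ∷ entry (# 17 , # 6 , # 9) (# 17) (# 9) (# 6) (# 3) (# 2)
  ∷ [])

p-60-72 : PairRecipe
p-60-72 = pairRecipe (# 6 , # 0) (# 7 , # 2)
  ( entry (# 0 , # 1 , # 2) (# 0) (# 1) (# 2) (# 6) (# 6)
  ∷ entry (# 3 , # 4 , # 5) (# 3) (# 4) (# 5) (# 6) (# 6)
  ∷ entry (# 10 , # 11 , # 12) (# 11) (# 12) (# 10) (# 3) (# 2)
  ∷ entry (# 11 , # 12 , # 13) (# 11) (# 12) (# 13) (# 3) (# 2)
  ∷ entry (# 13 , # 14 , # 15) (# 14) (# 15) (# 13) (# 6) (# 4)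
  ∷ entry (# 17 , # 7 , # 10) (# 17) (# 7) (# 10) (# 6) (# 4)
  ∷ entry (# 16 , # 6 , # 8) (# 16) (# 6) (# 8) (# 6) (# 6)
  ∷ [])

p-61-72 : PairRecipe
p-61-72 = pairRecipe (# 6 , # 1) (# 7 , # 2)
  ( entry (# 0 , # 1 , # 2) (# 0) (# 1) (# 2) (# 6) (# 6)
  ∷ entry (# 3 , # 4 , # 5) (# 3) (# 4) (# 5) (# 6) (# 6)
  ∷ entry (# 10 , # 11 , # 12) (# 11) (# 12) (# 10) (# 3) (# 2)
  ∷ entry (# 11 , # 12 , # 13) (# 11) (# 12) (# 13) (# 3) (# 2)
  ∷ entry (# 13 , # 14 , # 15) (# 14) (# 15) (# 13) (# 6) (# 4)
  ∷ entry (# 17 , # 7 , # 10) (# 17) (# 7) (# 10) (# 6) (# 4)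
  ∷ entry (# 16 , # 6 , # 9) (# 16) (# 6) (# 9) (# 6) (# 6)
  ∷ [])

p-65-73 : PairRecipe
p-65-73 = pairRecipe (# 6 , # 5) (# 7 , # 3)
  ( entry (# 0 , # 1 , # 2) (# 0) (# 1) (# 2) (# 6) (# 4)
  ∷ entry (# 2 , # 3 , # 4) (# 2) (# 3) (# 4) (# 2) (# 2)
  ∷ entry (# 3 , # 4 , # 5) (# 3) (# 4) (# 5) (# 4) (# 3)
  ∷ entry (# 5 , # 6 , # 7) (# 5) (# 6) (# 7) (# 3) (# 2)
  ∷ entry (# 8 , # 9 , # 10) (# 8) (# 9) (# 10) (# 6) (# 4)
  ∷ entry (# 10 , # 11 , # 12) (# 11) (# 12) (# 10) (# 3) (# 2)
  ∷ entry (# 13 , # 14 , # 15) (# 14) (# 15) (# 13) (# 6) (# 4)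
  ∷ entry (# 17 , # 6 , # 13) (# 17) (# 6) (# 13) (# 3) (# 2)
  ∷ entry (# 16 , # 7 , # 11) (# 16) (# 7) (# 11) (# 4) (# 3)
  ∷ [])

p-65-74 : PairRecipe
p-65-74 = pairRecipe (# 6 , # 5) (# 7 , # 4)
  ( entry (# 0 , # 1 , # 2) (# 0) (# 1) (# 2) (# 6) (# 4)
  ∷ entry (# 2 , # 3 , # 4) (# 2) (# 3) (# 4) (# 2) (# 2)
  ∷ entry (# 3 , # 4 , # 5) (# 3) (# 4) (# 5) (# 4) (# 3)
  ∷ entry (# 5 , # 6 , # 7) (# 5) (# 6) (# 7) (# 3) (# 2)
  ∷ entry (# 8 , # 9 , # 10) (# 8) (# 9) (# 10) (# 6) (# 4)
  ∷ entry (# 10 , # 11 , # 12) (# 11) (# 12) (# 10) (# 3) (# 2)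
  ∷ entry (# 13 , # 14 , # 15) (# 14) (# 15) (# 13) (# 6) (# 4)
  ∷ entry (# 17 , # 6 , # 13) (# 17) (# 6) (# 13) (# 3) (# 2)
  ∷ entry (# 16 , # 7 , # 12) (# 16) (# 7) (# 12) (# 4) (# 3)
  ∷ [])

p-73-74 : PairRecipe
p-73-74 = pairRecipe (# 7 , # 3) (# 7 , # 4)
  ( entry (# 0 , # 1 , # 2) (# 0) (# 1) (# 2) (# 6) (# 4)
  ∷ entry (# 2 , # 3 , # 4) (# 2) (# 3) (# 4) (# 2) (# 2)
  ∷ entry (# 3 , # 4 , # 5) (# 3) (# 4) (# 5) (# 4) (# 3)
  ∷ entry (# 5 , # 6 , # 7) (# 5) (# 6) (# 7) (# 3) (# 2)
  ∷ entry (# 8 , # 9 , # 10) (# 8) (# 9) (# 10) (# 6) (# 4)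
  ∷ entry (# 10 , # 11 , # 12) (# 11) (# 12) (# 10) (# 3) (# 2)
  ∷ entry (# 13 , # 14 , # 15) (# 13) (# 14) (# 15) (# 6) (# 6)
  ∷ entry (# 17 , # 7 , # 11) (# 17) (# 11) (# 7) (# 3) (# 2)
  ∷ entry (# 17 , # 7 , # 12) (# 17) (# 12) (# 7) (# 3) (# 2)
  ∷ [])

p-63-64 : PairRecipe
p-63-64 = pairRecipe (# 6 , # 3) (# 6 , # 4)
  ( entry (# 0 , # 1 , # 2) (# 0) (# 1) (# 2) (# 6) (# 4)
  ∷ entry (# 2 , # 3 , # 4) (# 2) (# 3) (# 4) (# 2) (# 2)
  ∷ entry (# 3 , # 4 , # 5) (# 3) (# 4) (# 5) (# 4) (# 3)
  ∷ entry (# 5 , # 6 , # 7) (# 5) (# 7) (# 6) (# 3) (# 2)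
  ∷ entry (# 8 , # 9 , # 10) (# 8) (# 9) (# 10) (# 6) (# 4)
  ∷ entry (# 10 , # 11 , # 12) (# 11) (# 12) (# 10) (# 3) (# 2)
  ∷ entry (# 13 , # 14 , # 15) (# 13) (# 14) (# 15) (# 6) (# 6)
  ∷ entry (# 17 , # 6 , # 11) (# 17) (# 11) (# 6) (# 3) (# 2)
  ∷ entry (# 17 , # 6 , # 12) (# 17) (# 12) (# 6) (# 3) (# 2)
  ∷ [])

p-63-75 : PairRecipe
p-63-75 = pairRecipe (# 6 , # 3) (# 7 , # 5)
  ( entry (# 0 , # 1 , # 2) (# 0) (# 1) (# 2) (# 6) (# 4)
  ∷ entry (# 2 , # 3 , # 4) (# 2) (# 3) (# 4) (# 2) (# 2)
  ∷ entry (# 3 , # 4 , # 5) (# 3) (# 4) (# 5) (# 4) (# 3)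
  ∷ entry (# 5 , # 6 , # 7) (# 5) (# 7) (# 6) (# 3) (# 2)
  ∷ entry (# 8 , # 9 , # 10) (# 8) (# 9) (# 10) (# 6) (# 4)
  ∷ entry (# 10 , # 11 , # 12) (# 11) (# 12) (# 10) (# 3) (# 2)
  ∷ entry (# 13 , # 14 , # 15) (# 14) (# 15) (# 13) (# 6) (# 4)
  ∷ entry (# 17 , # 7 , # 13) (# 17) (# 7) (# 13) (# 3) (# 2)
  ∷ entry (# 16 , # 6 , # 11) (# 16) (# 6) (# 11) (# 4) (# 3)
  ∷ [])

p-64-75 : PairRecipe
p-64-75 = pairRecipe (# 6 , # 4) (# 7 , # 5)
  ( entry (# 0 , # 1 , # 2) (# 0) (# 1) (# 2) (# 6) (# 4)
  ∷ entry (# 2 , # 3 , # 4) (# 2) (# 3) (# 4) (# 2) (# 2)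
  ∷ entry (# 3 , # 4 , # 5) (# 3) (# 4) (# 5) (# 4) (# 3)
  ∷ entry (# 5 , # 6 , # 7) (# 5) (# 7) (# 6) (# 3) (# 2)
  ∷ entry (# 8 , # 9 , # 10) (# 8) (# 9) (# 10) (# 6) (# 4)
  ∷ entry (# 10 , # 11 , # 12) (# 11) (# 12) (# 10) (# 3) (# 2)
  ∷ entry (# 13 , # 14 , # 15) (# 14) (# 15) (# 13) (# 6) (# 4)
  ∷ entry (# 17 , # 7 , # 13) (# 17) (# 7) (# 13) (# 3) (# 2)
  ∷ entry (# 16 , # 6 , # 12) (# 16) (# 6) (# 12) (# 4) (# 3)
  ∷ [])

classCertified : All (λ k → Certified (members k)) (allFin 28)
classCertified =
  singleton _ ∷
  singleton _ ∷
  singleton _ ∷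
  singleton _ ∷
  singleton _ ∷
  singleton _ ∷
  singleton _ ∷
  singleton _ ∷
  singleton _ ∷
  singleton _ ∷
  triple (by-recipe p-01-11) (by-recipe p-01-20) (by-recipe p-11-20) ∷
  triple (by-recipe p-00-10) (by-recipe p-00-21) (by-recipe p-10-21) ∷
  triple (by-recipe p-02-13) (by-recipe p-02-14) (by-recipe p-13-14) ∷
  triple (by-recipe p-03-04) (by-recipe p-03-12) (by-recipe p-04-12) ∷
  triple (by-recipe p-05-16) (by-recipe p-05-17) (by-recipe p-16-17) ∷
  triple (by-recipe p-06-07) (by-recipe p-06-15) (by-recipe p-07-15) ∷
  triple (by-recipe p-23-34) (by-recipe p-23-44) (by-recipe p-34-44) ∷
  triple (by-recipe p-24-33) (by-recipe p-24-43) (by-recipe p-33-43) ∷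
  triple (by-recipe p-32-40) (by-recipe p-32-41) (by-recipe p-40-41) ∷
  triple (by-recipe p-30-31) (by-recipe p-30-42) (by-recipe p-31-42) ∷
  triple (by-recipe p-35-46) (by-recipe p-35-47) (by-recipe p-46-47) ∷
  triple (by-recipe p-36-37) (by-recipe p-36-45) (by-recipe p-37-45) ∷
  triple (by-recipe p-26-67) (by-recipe p-26-77) (by-recipe p-67-77) ∷
  triple (by-recipe p-27-66) (by-recipe p-27-76) (by-recipe p-66-76) ∷
  triple (by-recipe p-62-70) (by-recipe p-62-71) (by-recipe p-70-71) ∷
  triple (by-recipe p-60-61) (by-recipe p-60-72) (by-recipe p-61-72) ∷
  triple (by-recipe p-65-73) (by-recipe p-65-74) (by-recipe p-73-74) ∷
  triple (by-recipe p-63-64) (by-recipe p-63-75) (by-recipe p-64-75) ∷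
  []

-- Lemma 3.8.  Since deg(u) = |S| ≥ 29 > 28, some class contains two cells of S, and the
-- certificate of that class gives the tiling.

lemma3p8 : (S : Fin 8 → Fin 8 → Bool) → InL29 S →
    ∃[ h ] (IsFracHomMTiling (L-edges S) h ×
            HMinAtLeast (L-edges S) h (+ 1 / 3) ×
            (+ 49 / 3) ≤ weight (L-edges S) h)
lemma3p8 S (_ , 29≤deg) =
  let k , two-cells = pigeonhole cellClass (presence S) cells (subst (28 ℕ.<_) (deg-u S) 29≤deg)
  in All.lookup classCertified (∈-allFin k) S two-cells
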